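{- Let $n,s,t, k_1, \ldots, k_t \in \mathbb{N}$. For each $i \in \{1,\ldots,t\}$, let $\mathbf{B}_i$ be a $k_i$-supernilpotent expanded elementary abelian group with $|\mathbf{B}_i| = p_i^{\alpha_i}$, where $p_i$ is a prime and $\alpha_i \in \mathbb{N}$ (all $\mathbf{B}_i$ of the same similarity type). Let $\mathbf{A} := \prod_{i=1}^t \mathbf{B}_i$, let $F \in \mathrm{Pol}_{n,s} (\mathbf{A})$, and let $\mathbf{a} \in A^n$. Then there is $\mathbf{y} \in A^n$ with $\operatorname{wt} (\mathbf{y}) \le \sum_{i = 1}^t k_i s \alpha_i (p_i-1)$ such that $F (\mathbf{a}) = F (\mathbf{y})$.
   Context: An expanded elementary abelian group is an algebra $(B;+,-,0,(f_j)_{j\in S})$ whose reduct $(B;+,-,0)$ is an elementary abelian group. The direct product $\mathbf{A}$ carries the componentwise operations; its zero $0$ is the tuple of zeros. $\mathrm{Pol}_n(\mathbf{A})$ is the set of $n$-ary polynomial functions of $\mathbf{A}$ (term functions of the expansion by all constants), and $\mathrm{Pol}_{n,s}(\mathbf{A})$ is the set of maps $A^n\to A^s$, $\mathbf{a}\mapsto(f_1(\mathbf{a}),\ldots,f_s(\mathbf{a}))$ with $f_1,\ldots,f_s\in\mathrm{Pol}_n(\mathbf{A})$. The weight of $\mathbf{y}\in A^n$ is $\operatorname{wt}(\mathbf{y}):=|\{j : \mathbf{y}(j)\neq 0\}|$. Higher commutators: for congruences $\alpha_1,\ldots,\alpha_r,\beta$ of an algebra ($r\ge 2$), $C(\alpha_1,\ldots,\alpha_r;\beta)$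 holds if for every term function $t$ and all tuples $\mathbf{a}_i\,\alpha_i\,\mathbf{b}_i$ (componentwise): if $t(\mathbf{x}_1,\ldots,\mathbf{x}_{r-1},\mathbf{a}_r)\,\beta\,t(\mathbf{x}_1,\ldots,\mathbf{x}_{r-1},\mathbf{b}_r)$ for all $(\mathbf{x}_1,\ldots,\mathbf{x}_{r-1})\in\prod_{i<r}\{\mathbf{a}_i,\mathbf{b}_i\}$ other than $(\mathbf{b}_1,\ldots,\mathbf{b}_{r-1})$, then $t(\mathbf{b}_1,\ldots,\mathbf{b}_{r-1},\mathbf{a}_r)\,\beta\,t(\mathbf{b}_1,\ldots,\mathbf{b}_{r-1},\mathbf{b}_r)$. $[\alpha_1,\ldots,\alpha_r]$ is the least such $\beta$. An algebra is $k$-supernilpotent if $[1,\ldots,1]$ ($k+1$ entries, $1$ the total congruence) is the identity congruence. -}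

module Defs where

open import Data.Nat using (ℕ; zero; suc; _+_; _*_; _∸_)
open import Data.Nat.Primality using (Prime)
open import Data.Fin using (Fin)
import Data.Fin.Properties as FinP
open import Data.Bool using (Bool; true; false; if_then_else_)
open import Data.Product using (Σ; _×_; _,_)
open import Data.Sum using (_⊎_; inj₁; inj₂; [_,_])
open import Data.Unit using (⊤; tt)
open import Data.List using (List; length; filter; tabulate)
open import Data.Nat.ListAction using (sum)
open import Relation.Binary.PropositionalEquality using (_≡_; refl; sym; trans; cong)
open import Relation.Binary.Definitions using (DecidableEquality)
open import Relation.Nullary using (¬_; Dec; yes; no; ¬?)
open import Function.Bundles using (_↔_; Inverse)
open import Algebra.Structures using (IsAbelianGroup)

-- Similarity type: the basic operations are +, -, 0 (fixed) together
-- with operation symbols f_j (j ∈ Op) of arity (arity j).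

record Signature : Set₁ where
  field
    Op    : Set
    arity : Op → ℕ

module _ (σ : Signature) where
  open Signature σ

  record Algebra : Set₁ where
    field
      Carrier : Set
      _⊕_     : Carrier → Carrier → Carrier
      ⊖_      : Carrier → Carrier
      𝟎       : Carrier
      op      : (j : Op) → (Fin (arity j) → Carrier) → Carrier

  data Term (V : Set) : Set where
    var  : V → Term V
    plus : Term V → Term V → Term V
    neg  : Term V → Term V
    zer  : Term V
    app  : (j : Op) → (Fin (arity j) → Term V) → Term V

  eval : (B : Algebra) {V : Set} → Term V → (V → Algebra.Carrier B) → Algebra.Carrier B
  eval B (var v)    ρ = ρ v
  eval B (plus u w) ρ = Algebra._⊕_ B (eval B u ρ) (eval B w ρ)
  eval B (neg u)    ρ = Algebra.⊖_ B (eval B u ρ)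
  eval B zer        ρ = Algebra.𝟎 B
  eval B (app j us) ρ = Algebra.op B j (λ i → eval B (us i) ρ)

  -- Polynomials: terms of the expansion by all constants, i.e. terms whose
  -- variables are either genuine variables (inj₁) or constants (inj₂).
  PolTerm : (B : Algebra) → Set → Set
  PolTerm B V = Term (V ⊎ Algebra.Carrier B)

  evalPol : (B : Algebra) {V : Set} → PolTerm B V → (V → Algebra.Carrier B) → Algebra.Carrier B
  evalPol B u ρ = eval B u [ ρ , (λ c → c) ]

  PolMap : (B : Algebra) (n s : ℕ) → (Fin s → PolTerm B (Fin n)) →
           (Fin n → Algebra.Carrier B) → Fin s → Algebra.Carrier B
  PolMap B n s F a l = evalPol B (F l) a

  _·_ : {B : Algebra} → ℕ → Algebra.Carrier B → Algebra.Carrier B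
  _·_ {B} zero    x = Algebra.𝟎 B
  _·_ {B} (suc m) x = Algebra._⊕_ B x (_·_ {B} m x)

  record IsExpElemAbelian (B : Algebra) : Set where
    open Algebra B
    field
      isAbelianGroup : IsAbelianGroup _≡_ _⊕_ 𝟎 ⊖_
      exponent       : ℕ
      exponent-prime : Prime exponent
      exponent-kills : ∀ x → _·_ {B} exponent x ≡ 𝟎

  Rel : Algebra → Set₁
  Rel B = Algebra.Carrier B → Algebra.Carrier B → Set

  record IsCongruence (B : Algebra) (θ : Rel B) : Set where
    open Algebra B
    field
      θ-refl   : ∀ {x} → θ x x
      θ-sym    : ∀ {x y} → θ x y → θ y x
      θ-trans  : ∀ {x y z} → θ x y → θ y z → θ x z
      θ-plus   : ∀ {x x′ y y′} → θ x x′ → θ y y′ → θ (x ⊕ y) (x′ ⊕ y′)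
      θ-neg    : ∀ {x x′} → θ x x′ → θ (⊖ x) (⊖ x′)
      θ-op     : ∀ j {u v : Fin (arity j) → Carrier} →
                 (∀ i → θ (u i) (v i)) → θ (op j u) (op j v)

  𝟏ᶜ : (B : Algebra) → Rel B
  𝟏ᶜ B _ _ = ⊤

  Δᶜ : (B : Algebra) → Rel B
  Δᶜ B x y = x ≡ y

  -- Higher commutator condition C(α_1,…,α_q, α_r ; β) with r = q + 1.
  -- The term t has a block of m i variables for each i < r and a last
  -- block of mr variables.  A choice c : Fin q → Bool selects a_i (false)
  -- or b_i (true) for the first q blocks.
  module _ (B : Algebra) {q : ℕ} {m : Fin q → ℕ} {mr : ℕ}
           (a b : (i : Fin q) → Fin (m i) → Algebra.Carrier B) where
    env : (Fin q → Bool) → (Fin mr → Algebra.Carrier B) →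
          (Σ (Fin q) (λ i → Fin (m i)) ⊎ Fin mr) → Algebra.Carrier B
    env c z (inj₁ (i , j)) = if c i then b i j else a i j
    env c z (inj₂ j)       = z j

  C : (B : Algebra) (q : ℕ) (α : Fin q → Rel B) (αr : Rel B) (β : Rel B) → Set
  C B q α αr β =
    (m : Fin q → ℕ) (mr : ℕ) (t : Term (Σ (Fin q) (λ i → Fin (m i)) ⊎ Fin mr))
    (a b : (i : Fin q) → Fin (m i) → Algebra.Carrier B)
    (ar br : Fin mr → Algebra.Carrier B) →
    (∀ i j → α i (a i j) (b i j)) → (∀ j → αr (ar j) (br j)) →
    (∀ (c : Fin q → Bool) → ¬ (∀ i → c i ≡ true) →
       β (eval B t (env B a b c ar)) (eval B t (env B a b c br))) →
    β (eval B t (env B a b (λ _ → true) ar)) (eval B t (env B a b (λ _ → true) br))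

  CommutatorIs : (B : Algebra) (q : ℕ) (α : Fin q → Rel B) (αr : Rel B) (β : Rel B) → Set₁
  CommutatorIs B q α αr β =
    IsCongruence B β × C B q α αr β ×
    (∀ (β′ : Rel B) → IsCongruence B β′ → C B q α αr β′ → ∀ x y → β x y → β′ x y)

  -- k-supernilpotent: [1, …, 1] (k+1 entries) = 0.
  SuperNilpotent : ℕ → Algebra → Set₁
  SuperNilpotent k B = CommutatorIs B k (λ _ → 𝟏ᶜ B) (𝟏ᶜ B) (Δᶜ B)

  Prod : {t : ℕ} → (Fin t → Algebra) → Algebra
  Prod {t} B = record
    { Carrier = (i : Fin t) → Algebra.Carrier (B i)
    ; _⊕_     = λ x y i → Algebra._⊕_ (B i) (x i) (y i)
    ; ⊖_      = λ x i → Algebra.⊖_ (B i) (x i)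
    ; 𝟎       = λ i → Algebra.𝟎 (B i)
    ; op      = λ j u i → Algebra.op (B i) j (λ l → u l i)
    }

  _≈ᴾ_ : {t : ℕ} {B : Fin t → Algebra} → Algebra.Carrier (Prod B) → Algebra.Carrier (Prod B) → Set
  x ≈ᴾ y = ∀ i → x i ≡ y i

  wt : {t n : ℕ} (B : Fin t → Algebra) →
       (∀ i → DecidableEquality (Algebra.Carrier (B i))) →
       (Fin n → Algebra.Carrier (Prod B)) → ℕ
  wt {t} {n} B deq y =
    length (filter (λ j → ¬? (FinP.all? (λ i → deq i (y j i) (Algebra.𝟎 (B i)))))
                   (tabulate {n = n} (λ j → j)))

↔Fin-deq : {X : Set} {m : ℕ} → X ↔ Fin m → DecidableEquality X
↔Fin-deq e x y with Inverse.to e x FinP.≟ Inverse.to e y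
... | yes p = yes (trans (sym (Inverse.strictlyInverseʳ e x))
                      (trans (cong (Inverse.from e) p) (Inverse.strictlyInverseʳ e y)))
... | no ¬p = no (λ x≡y → ¬p (cong (Inverse.to e) x≡y))

Σ[<_]_ : (t : ℕ) → (Fin t → ℕ) → ℕ
Σ[< t ] f = sum (tabulate f)

-- Work in one factor B, of prime exponent q, and take a ∈ Bⁿ whose support exceeds k s α (p − 1).  For x in
-- the cube {0,1}ⁿ let aₓ be a with the coordinates selected by x replaced by 0.  Supernilpotence makes every
-- (k+1)-fold finite difference of x ↦ F(aₓ) vanish, so the coordinates of F(aₓ) with respect to an F_q-basis
-- of B (of size α, since q^dim = p^α forces q = p) are polynomials of degree at most k over ℤ/q.  Hence
--   P(x) = ∏_{a_v = 0} (1 − x_v) · ∏_{l,i} ∏_{t ≠ F(a)_{l,i}} (F(aₓ)_{l,i} − t)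
-- has degree at most #{v | a_v = 0} + k s α (p − 1) < n and P(0) ≠ 0.  A polynomial of degree below n cannot
-- be supported at the origin of the n-cube alone, so P(x) ≠ 0 for some x ≠ 0: then F(aₓ) = F(a) and aₓ has
-- smaller support.  Iterating gives the bound in each factor, and the weight of a tuple in the product is at
-- most the sum of the supports of its components.

module Submission where

open import Defs
open import Data.Nat using (ℕ; suc; _^_)
open import Data.Nat.Primality using (Prime)
open import Data.Fin using (Fin)
open import Data.Sum using (_⊎_)
open import Relation.Binary.PropositionalEquality using (_≡_)
open import Algebra.Structures using (IsAbelianGroup)
open import Function.Bundles using (_↔_)

module IntegersModulo (q : ℕ) where

  open import Data.Nat as ℕ using (NonZero; _<_)
  import Data.Nat.Properties as ℕ
  import Data.Nat.Divisibility as ℕ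
  open import Data.Nat.DivMod using (_%_; _/_; m≡m%n+[m/n]*n)
  open import Data.Nat.Primality using (euclidsLemma)
  open import Data.Integer as ℤ using (ℤ; +_; _+_; _*_; -_; _-_; ∣_∣)
  import Data.Integer.Properties as ℤ
  open import Data.Integer.Divisibility.Signed
  open import Data.Integer.Tactic.RingSolver using (solve-∀)
  open import Data.Product using (_,_)
  open import Data.Sum using (inj₁; inj₂)
  open import Relation.Binary.PropositionalEquality
  open import Relation.Binary.Definitions using (Decidable)
  open import Relation.Nullary using (¬_; yes; no; map′)
  open import Algebra.Bundles using (CommutativeRing)
  open import Algebra.Structures using (IsCommutativeRing)
  open import Level using (0ℓ)

  infix 4 _≋_ _≉_ _≋?_

  -- A record rather than a synonym for q ∣ x - y, so that x and y can be inferred.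
  record _≋_ (x y : ℤ) : Set where
    constructor ≋-intro
    field divides-difference : + q ∣ x - y

  open _≋_ public

  _≉_ : ℤ → ℤ → Set
  x ≉ y = ¬ x ≋ y

  private
    via : ∀ {d e} → d ≡ e → + q ∣ d → + q ∣ e
    via = subst (+ q ∣_)

  ≡⇒≋ : ∀ {x y} → x ≡ y → x ≋ y
  ≡⇒≋ {x} refl = ≋-intro (via (sym (ℤ.+-inverseʳ x)) (divides (+ 0) refl))

  ≋-refl : ∀ {x} → x ≋ x
  ≋-refl = ≡⇒≋ refl

  ≋-sym : ∀ {x y} → x ≋ y → y ≋ x
  ≋-sym {x} {y} (≋-intro d) = ≋-intro (via (law x y) (∣m⇒∣-m d))
    where law : ∀ x y → - (x - y) ≡ y - x
          law = solve-∀

  ≋-trans : ∀ {x y z} → x ≋ y → y ≋ z → x ≋ z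
  ≋-trans {x} {y} {z} (≋-intro d) (≋-intro e) = ≋-intro (via (law x y z) (∣m∣n⇒∣m+n d e))
    where law : ∀ x y z → (x - y) + (y - z) ≡ x - z
          law = solve-∀

  +-cong : ∀ {x y u v} → x ≋ y → u ≋ v → x + u ≋ y + v
  +-cong {x} {y} {u} {v} (≋-intro d) (≋-intro e) = ≋-intro (via (law x y u v) (∣m∣n⇒∣m+n d e))
    where law : ∀ x y u v → (x - y) + (u - v) ≡ (x + u) - (y + v)
          law = solve-∀

  *-cong : ∀ {x y u v} → x ≋ y → u ≋ v → x * u ≋ y * v
  *-cong {x} {y} {u} {v} (≋-intro d) (≋-intro e) =
    ≋-intro (via (law x y u v) (∣m∣n⇒∣m+n (∣n⇒∣m*n x e) (∣m⇒∣m*n v d)))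
    where law : ∀ x y u v → x * (u - v) + (x - y) * v ≡ x * u - y * v
          law = solve-∀

  -‿cong : ∀ {x y} → x ≋ y → - x ≋ - y
  -‿cong {x} {y} (≋-intro d) = ≋-intro (via (law x y) (∣m⇒∣-m d))
    where law : ∀ x y → - (x - y) ≡ - x - - y
          law = solve-∀

  isCommutativeRing : IsCommutativeRing _≋_ _+_ _*_ -_ (+ 0) (+ 1)
  isCommutativeRing = record
    { isRing = record
      { +-isAbelianGroup = record
        { isGroup = record
          { isMonoid = record
            { isSemigroup = record
              { isMagma = record
                { isEquivalence = record { refl = ≋-refl ; sym = ≋-sym ; trans = ≋-trans }
                ; ∙-cong = +-cong }
              ; assoc = λ x y z → ≡⇒≋ (ℤ.+-assoc x y z) }
            ; identity = (λ x → ≡⇒≋ (ℤ.+-identityˡ x)) , (λ x → ≡⇒≋ (ℤ.+-identityʳ x)) }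
          ; inverse = (λ x → ≡⇒≋ (ℤ.+-inverseˡ x)) , (λ x → ≡⇒≋ (ℤ.+-inverseʳ x))
          ; ⁻¹-cong = -‿cong }
        ; comm = λ x y → ≡⇒≋ (ℤ.+-comm x y) }
      ; *-cong = *-cong
      ; *-assoc = λ x y z → ≡⇒≋ (ℤ.*-assoc x y z)
      ; *-identity = (λ x → ≡⇒≋ (ℤ.*-identityˡ x)) , (λ x → ≡⇒≋ (ℤ.*-identityʳ x))
      ; distrib = (λ x y z → ≡⇒≋ (ℤ.*-distribˡ-+ x y z)) , (λ x y z → ≡⇒≋ (ℤ.*-distribʳ-+ x y z)) }
    ; *-comm = λ x y → ≡⇒≋ (ℤ.*-comm x y) }

  commutativeRing : CommutativeRing 0ℓ 0ℓ
  commutativeRing = record { isCommutativeRing = isCommutativeRing }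

  ≋0⇒∣ : ∀ {x} → x ≋ + 0 → q ℕ.∣ ∣ x ∣
  ≋0⇒∣ {x} (≋-intro d) = ∣⇒∣ᵤ (via (ℤ.+-identityʳ x) d)

  ∣⇒≋0 : ∀ {x} → q ℕ.∣ ∣ x ∣ → x ≋ + 0
  ∣⇒≋0 {x} d = ≋-intro (via (sym (ℤ.+-identityʳ x)) (∣ᵤ⇒∣ d))

  _≋?_ : Decidable _≋_
  x ≋? y = map′ ≋-intro divides-difference (+ q ∣? x - y)

  %-≋ : .{{_ : NonZero q}} → ∀ m → + (m % q) ≋ + m
  %-≋ m = ≋-sym (≋-intro (divides (+ (m / q)) difference))
    where
    law : ∀ x y → (x + y) - x ≡ y
    law = solve-∀
    difference : + m - + (m % q) ≡ + (m / q) * + q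
    difference = begin
      + m - + (m % q)                          ≡⟨ cong (λ z → + z - + (m % q)) (m≡m%n+[m/n]*n m q) ⟩
      + (m % q ℕ.+ m / q ℕ.* q) - + (m % q)    ≡⟨ cong (_- + (m % q)) (ℤ.pos-+ (m % q) (m / q ℕ.* q)) ⟩
      (+ (m % q) + + (m / q ℕ.* q)) - + (m % q) ≡⟨ law (+ (m % q)) (+ (m / q ℕ.* q)) ⟩
      + (m / q ℕ.* q)                          ≡⟨ ℤ.pos-* (m / q) q ⟩
      + (m / q) * + q                          ∎
      where open ≡-Reasoning

  module _ (q-prime : Prime q) where

    *-≉0 : ∀ {x y} → x ≉ + 0 → y ≉ + 0 → x * y ≉ + 0
    *-≉0 {x} {y} x≉0 y≉0 xy≋0
      with euclidsLemma ∣ x ∣ ∣ y ∣ q-prime (subst (q ℕ.∣_) (ℤ.abs-* x y) (≋0⇒∣ xy≋0))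
    ... | inj₁ q∣x = x≉0 (∣⇒≋0 q∣x)
    ... | inj₂ q∣y = y≉0 (∣⇒≋0 q∣y)

    distinctResidues : ∀ {a b} → a < q → b < q → a ≢ b → + a - + b ≉ + 0
    distinctResidues {a} {b} a<q b<q a≢b a-b≋0 with ∣ + a - + b ∣ ℕ.≟ 0
    ... | yes ∣a-b∣≡0 = a≢b (ℤ.+-injective (ℤ.i-j≡0⇒i≡j (+ a) (+ b) (ℤ.∣i∣≡0⇒i≡0 ∣a-b∣≡0)))
    ... | no ∣a-b∣≢0 = ℕ.<-irrefl refl (ℕ.<-≤-trans ∣a-b∣<q q≤∣a-b∣)
      where
      q≤∣a-b∣ : q ℕ.≤ ∣ + a - + b ∣
      q≤∣a-b∣ = ℕ.∣⇒≤ {{ℕ.≢-nonZero ∣a-b∣≢0}} (≋0⇒∣ a-b≋0)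
      ∣a-b∣<q : ∣ + a - + b ∣ < q
      ∣a-b∣<q = ℕ.≤-<-trans
        (subst (ℕ._≤ a ℕ.⊔ b) (cong ∣_∣ (sym (ℤ.[+m]-[+n]≡m⊖n a b))) (ℤ.∣m⊝n∣≤m⊔n a b))
        (ℕ.⊔-lub a<q b<q)

module FiniteSums where

  open import Data.Nat as ℕ using (zero; _+_; _*_; _≤_; _<_; z≤n)
  import Data.Nat.Properties as ℕ
  open import Data.Nat.Tactic.RingSolver using (solve-∀)
  open import Data.Fin using (zero; suc)
  import Data.Fin.Properties as Fin
  open import Data.List using (length; filter; tabulate)
  open import Data.Product using (_,_)
  open import Relation.Binary.PropositionalEquality
  open import Relation.Nullary using (Dec; yes; no; ¬_; ¬?; contradiction)

  indicator : ∀ {A : Set} → Dec A → ℕ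
  indicator (yes _) = 1
  indicator (no _)  = 0

  indicator+indicator¬≡1 : ∀ {A : Set} (d : Dec A) → indicator d + indicator (¬? d) ≡ 1
  indicator+indicator¬≡1 (yes _) = refl
  indicator+indicator¬≡1 (no _)  = refl

  Σ-cong : ∀ m {f g : Fin m → ℕ} → (∀ i → f i ≡ g i) → Σ[< m ] f ≡ Σ[< m ] g
  Σ-cong zero    f≡g = refl
  Σ-cong (suc m) f≡g = cong₂ _+_ (f≡g zero) (Σ-cong m (λ i → f≡g (suc i)))

  Σ-const : ∀ m c → Σ[< m ] (λ _ → c) ≡ m * c
  Σ-const zero    c = refl
  Σ-const (suc m) c = cong (c +_) (Σ-const m c)

  Σ-homo-+ : ∀ m (f g : Fin m → ℕ) → Σ[< m ] (λ i → f i + g i) ≡ Σ[< m ] f + Σ[< m ] g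
  Σ-homo-+ zero    f g = refl
  Σ-homo-+ (suc m) f g =
    trans (cong (f zero + g zero +_) (Σ-homo-+ m _ _)) (interchange (f zero) (g zero) _ _)
    where
    interchange : ∀ a b c d → (a + b) + (c + d) ≡ (a + c) + (b + d)
    interchange = solve-∀

  Σ-swap : ∀ m n (h : Fin m → Fin n → ℕ) → Σ[< m ] (λ i → Σ[< n ] (h i)) ≡ Σ[< n ] (λ j → Σ[< m ] (λ i → h i j))
  Σ-swap zero    n h = sym (trans (Σ-const n 0) (ℕ.*-zeroʳ n))
  Σ-swap (suc m) n h = trans (cong (Σ[< n ] (h zero) +_) (Σ-swap m n (λ i → h (suc i)))) (sym (Σ-homo-+ n _ _))

  Σ-mono-≤ : ∀ m {f g : Fin m → ℕ} → (∀ i → f i ≤ g i) → Σ[< m ] f ≤ Σ[< m ] g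
  Σ-mono-≤ zero    f≤g = z≤n
  Σ-mono-≤ (suc m) f≤g = ℕ.+-mono-≤ (f≤g zero) (Σ-mono-≤ m (λ i → f≤g (suc i)))

  Σ-mono-< : ∀ m {f g : Fin m → ℕ} → (∀ i → f i ≤ g i) → ∀ i → f i < g i → Σ[< m ] f < Σ[< m ] g
  Σ-mono-< (suc m) f≤g zero    f<g = ℕ.+-mono-<-≤ f<g (Σ-mono-≤ m (λ i → f≤g (suc i)))
  Σ-mono-< (suc m) f≤g (suc i) f<g = ℕ.+-mono-≤-< (f≤g zero) (Σ-mono-< m (λ i → f≤g (suc i)) i f<g)

  ≤Σ : ∀ m (f : Fin m → ℕ) i → f i ≤ Σ[< m ] f
  ≤Σ (suc m) f zero    = ℕ.m≤m+n (f zero) _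
  ≤Σ (suc m) f (suc i) = ℕ.≤-trans (≤Σ m (λ i → f (suc i)) i) (ℕ.m≤n+m _ (f zero))

  indicator-yes : ∀ {A : Set} (d : Dec A) → A → indicator d ≡ 1
  indicator-yes (yes _) _ = refl
  indicator-yes (no ¬a) a = contradiction a ¬a

  indicator-no : ∀ {A : Set} (d : Dec A) → ¬ A → indicator d ≡ 0
  indicator-no (yes a) ¬a = contradiction a ¬a
  indicator-no (no _)  _  = refl

  indicator¬all≤Σ : ∀ m {P : Fin m → Set} (P? : ∀ i → Dec (P i)) →
                    indicator (¬? (Fin.all? P?)) ≤ Σ[< m ] (λ i → indicator (¬? (P? i)))
  indicator¬all≤Σ m P? with Fin.all? P?
  ... | yes _    = z≤n
  ... | no ¬all with Fin.¬∀⟶∃¬ m _ P? ¬all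
  ... | i , ¬Pi = subst (_≤ Σ[< m ] (λ i → indicator (¬? (P? i)))) (indicator-yes (¬? (P? i)) ¬Pi) (≤Σ m _ i)

  length-filter-tabulate : ∀ m {n} {P : Fin n → Set} (P? : ∀ j → Dec (P j)) (f : Fin m → Fin n) →
                           length (filter P? (tabulate f)) ≡ Σ[< m ] (λ i → indicator (P? (f i)))
  length-filter-tabulate zero    P? f = refl
  length-filter-tabulate (suc m) P? f with P? (f zero)
  ... | yes _ = cong suc (length-filter-tabulate m P? (λ i → f (suc i)))
  ... | no _  = length-filter-tabulate m P? (λ i → f (suc i))

module BooleanCube where

  open import Data.Nat as ℕ using (zero; _<_; s≤s)
  open import Data.Nat.Properties using (+-suc)
  open import Data.Fin using (zero; suc; _≟_)
  open import Data.Vec using (Vec; []; _∷_; lookup; _[_]≔_; replicate)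
  open import Data.Vec.Properties using ([]≔-idempotent; []≔-commutes; lookup∘update; lookup∘update′)
  open import Data.Bool using (Bool; true; false)
  open import Data.Maybe as Maybe using (Maybe; just; nothing; maybe′)
  open import Function using (_∘_)
  open import Relation.Binary.PropositionalEquality as ≡ using (_≡_; _≢_)
  open import Relation.Nullary using (Dec; yes; no; map′; contradiction)
  open import Relation.Nullary.Decidable using (_⊎-dec_)
  open import Data.Product using (∃; _,_)
  open import Data.Sum using (_⊎_; inj₁; inj₂)
  open import Algebra.Bundles using (AbelianGroup; CommutativeRing)

  updateAll : ∀ {M K} → Vec (Fin M) K → Vec Bool K → Vec Bool M → Vec Bool M
  updateAll []       []      x = x
  updateAll (j ∷ js) (b ∷ c) x = updateAll js c x [ j ]≔ b

  firstIndexOf : ∀ {M K} → Fin M → Vec (Fin M) K → Maybe (Fin K)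
  firstIndexOf v []       = nothing
  firstIndexOf v (j ∷ js) with v ≟ j
  ... | yes _ = just zero
  ... | no _  = Maybe.map suc (firstIndexOf v js)

  lookup-updateAll : ∀ {M K} (js : Vec (Fin M) K) c x v →
                     lookup (updateAll js c x) v ≡ maybe′ (lookup c) (lookup x v) (firstIndexOf v js)
  lookup-updateAll []       []      x v = ≡.refl
  lookup-updateAll (j ∷ js) (b ∷ c) x v with v ≟ j
  ... | yes ≡.refl = lookup∘update v (updateAll js c x) b
  ... | no v≢j     = ≡.trans (lookup∘update′ v≢j (updateAll js c x) b) (shift (firstIndexOf v js) (lookup-updateAll js c x v))
    where
    shift : ∀ mi → lookup (updateAll js c x) v ≡ maybe′ (lookup c) (lookup x v) mi →
            lookup (updateAll js c x) v ≡ maybe′ (lookup (b ∷ c)) (lookup x v) (Maybe.map suc mi)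
    shift (just i) eq = eq
    shift nothing  eq = eq

  ∃-cube? : ∀ M {P : Vec Bool M → Set} → (∀ x → Dec (P x)) → Dec (∃ P)
  ∃-cube? zero    P? = map′ ([] ,_) (λ { ([] , p) → p }) (P? [])
  ∃-cube? (suc M) {P} P? = map′ join split (∃-cube? M (λ x → P? (true ∷ x)) ⊎-dec ∃-cube? M (λ x → P? (false ∷ x)))
    where
    join : (∃ λ x → P (true ∷ x)) ⊎ (∃ λ x → P (false ∷ x)) → ∃ P
    join (inj₁ (x , p)) = true ∷ x , p
    join (inj₂ (x , p)) = false ∷ x , p
    split : ∃ P → (∃ λ x → P (true ∷ x)) ⊎ (∃ λ x → P (false ∷ x))
    split (true ∷ x , p)  = inj₁ (x , p)
    split (false ∷ x , p) = inj₂ (x , p)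

  ≢replicate-false⇒∃true : ∀ {M} (x : Vec Bool M) → x ≢ replicate M false → ∃ λ v → lookup x v ≡ true
  ≢replicate-false⇒∃true []           x≢0 = contradiction ≡.refl x≢0
  ≢replicate-false⇒∃true (true ∷ x)  _   = zero , ≡.refl
  ≢replicate-false⇒∃true (false ∷ x) x≢0 with ≢replicate-false⇒∃true x (x≢0 ∘ ≡.cong (false ∷_))
  ... | v , x[v]≡true = suc v , x[v]≡true

  module Differences {c ℓ} (G : AbelianGroup c ℓ) where

    open AbelianGroup G renaming (_∙_ to infixl 6 _+_; _⁻¹ to infix 8 -_; ε to 0#; ∙-cong to +-cong; inverseʳ to -‿inverseʳ; ⁻¹-cong to -‿cong)
    open import Algebra.Properties.AbelianGroup G using (⁻¹-∙-comm)
    open import Algebra.Properties.Group group using (x∙y⁻¹≈ε⇒x≈y)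
    open import Algebra.Properties.CommutativeSemigroup commutativeSemigroup using (interchange)
    open import Relation.Binary.Reasoning.Setoid setoid

    −-cong : ∀ {a b c d} → a ≈ b → c ≈ d → a - c ≈ b - d
    −-cong a≈b c≈d = +-cong a≈b (-‿cong c≈d)

    x-x≈0 : ∀ x → x - x ≈ 0#
    x-x≈0 = -‿inverseʳ

    [a+b]-[c+d]≈[a-c]+[b-d] : ∀ a b c d → (a + b) - (c + d) ≈ (a - c) + (b - d)
    [a+b]-[c+d]≈[a-c]+[b-d] a b c d = trans (+-cong refl (sym (⁻¹-∙-comm c d))) (interchange a b (- c) (- d))

    [a-b]-[c-d]≈[a-c]-[b-d] : ∀ a b c d → (a - b) - (c - d) ≈ (a - c) - (b - d)
    [a-b]-[c-d]≈[a-c]-[b-d] a b c d =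
      trans ([a+b]-[c+d]≈[a-c]+[b-d] a (- b) c (- d)) (+-cong refl (⁻¹-∙-comm b (- d)))

    Δ : ∀ {M} → Fin M → (Vec Bool M → Carrier) → Vec Bool M → Carrier
    Δ j f x = f (x [ j ]≔ true) - f (x [ j ]≔ false)

    Δs : ∀ {M K} → Vec (Fin M) K → (Vec Bool M → Carrier) → Vec Bool M → Carrier
    Δs []       f = f
    Δs (j ∷ js) f = Δs js (Δ j f)

    Δ-cong : ∀ {M} {f g : Vec Bool M → Carrier} → (∀ x → f x ≈ g x) → ∀ j x → Δ j f x ≈ Δ j g x
    Δ-cong f≈g j x = −-cong (f≈g _) (f≈g _)

    Δs-cong : ∀ {M K} (js : Vec (Fin M) K) {f g : Vec Bool M → Carrier} →
              (∀ x → f x ≈ g x) → ∀ x → Δs js f x ≈ Δs js g x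
    Δs-cong []       f≈g = f≈g
    Δs-cong (j ∷ js) f≈g = Δs-cong js (Δ-cong f≈g j)

    Δ-homo-+ : ∀ {M} (f g : Vec Bool M → Carrier) j x → Δ j (λ y → f y + g y) x ≈ Δ j f x + Δ j g x
    Δ-homo-+ f g j x = [a+b]-[c+d]≈[a-c]+[b-d] _ _ _ _

    Δ-homo-− : ∀ {M} (f g : Vec Bool M → Carrier) j x → Δ j (λ y → f y - g y) x ≈ Δ j f x - Δ j g x
    Δ-homo-− f g j x = [a-b]-[c-d]≈[a-c]-[b-d] _ _ _ _

    alternatingSum : (K : ℕ) → (Vec Bool K → Carrier) → Carrier
    alternatingSum zero    φ = φ []
    alternatingSum (suc K) φ = alternatingSum K (λ c → φ (true ∷ c)) - alternatingSum K (λ c → φ (false ∷ c))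

    alternatingSum-cong : ∀ K {φ ψ : Vec Bool K → Carrier} → (∀ c → φ c ≈ ψ c) →
                          alternatingSum K φ ≈ alternatingSum K ψ
    alternatingSum-cong zero    φ≈ψ = φ≈ψ []
    alternatingSum-cong (suc K) φ≈ψ = −-cong (alternatingSum-cong K (λ c → φ≈ψ _)) (alternatingSum-cong K (λ c → φ≈ψ _))

    alternatingSum-zero : ∀ K {φ : Vec Bool K → Carrier} → (∀ c → φ c ≈ 0#) → alternatingSum K φ ≈ 0#
    alternatingSum-zero zero    φ≈0 = φ≈0 []
    alternatingSum-zero (suc K) φ≈0 =
      trans (−-cong (alternatingSum-zero K (λ c → φ≈0 _)) (alternatingSum-zero K (λ c → φ≈0 _))) (x-x≈0 0#)

    alternatingSum-homo-− : ∀ K (φ ψ : Vec Bool K → Carrier) →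
                            alternatingSum K (λ c → φ c - ψ c) ≈ alternatingSum K φ - alternatingSum K ψ
    alternatingSum-homo-− zero    φ ψ = refl
    alternatingSum-homo-− (suc K) φ ψ =
      trans (−-cong (alternatingSum-homo-− K _ _) (alternatingSum-homo-− K _ _)) ([a-b]-[c-d]≈[a-c]-[b-d] _ _ _ _)

    alternatingSum-constantIn : ∀ K (i : Fin K) (φ : Vec Bool K → Carrier) →
                                (∀ c b → φ c ≈ φ (c [ i ]≔ b)) → alternatingSum K φ ≈ 0#
    alternatingSum-constantIn (suc K) zero φ const =
      trans (−-cong (alternatingSum-cong K (λ c → const (true ∷ c) false)) refl) (x-x≈0 _)
    alternatingSum-constantIn (suc K) (suc i) φ const =
      trans (−-cong (alternatingSum-constantIn K i _ (λ c → const (true ∷ c)))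
                    (alternatingSum-constantIn K i _ (λ c → const (false ∷ c))))
            (x-x≈0 0#)

    alternatingSum-vanishingOffOrigin : ∀ K (φ : Vec Bool K → Carrier) →
      (∀ c → c ≢ replicate K false → φ c ≈ 0#) → alternatingSum K φ ≈ 0# → φ (replicate K false) ≈ 0#
    alternatingSum-vanishingOffOrigin zero    φ _     sum≈0 = sum≈0
    alternatingSum-vanishingOffOrigin (suc K) φ φ≈0 sum≈0 =
      alternatingSum-vanishingOffOrigin K (λ c → φ (false ∷ c))
        (λ c c≢0 → φ≈0 (false ∷ c) (λ eq → c≢0 (≡.cong Data.Vec.tail eq)))
        (sym (x∙y⁻¹≈ε⇒x≈y _ _ (begin
          0# - alternatingSum K (λ c → φ (false ∷ c))
            ≈⟨ −-cong (sym (alternatingSum-zero K (λ c → φ≈0 (true ∷ c) (λ ())))) refl ⟩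
          alternatingSum (suc K) φ
            ≈⟨ sum≈0 ⟩
          0# ∎)))

    Δs≈alternatingSum : ∀ {M K} (js : Vec (Fin M) K) f x →
                        Δs js f x ≈ alternatingSum K (λ c → f (updateAll js c x))
    Δs≈alternatingSum []                 f x = refl
    Δs≈alternatingSum {K = suc K} (j ∷ js) f x =
      trans (Δs≈alternatingSum js (Δ j f) x) (alternatingSum-homo-− K _ _)

  module Homomorphism {c₁ ℓ₁ c₂ ℓ₂} (G : AbelianGroup c₁ ℓ₁) (H : AbelianGroup c₂ ℓ₂)
    (h : AbelianGroup.Carrier G → AbelianGroup.Carrier H)
    (h-homo-− : ∀ x y → AbelianGroup._≈_ H (h (AbelianGroup._-_ G x y)) (AbelianGroup._-_ H (h x) (h y)))
    where

    private
      module G = Differences G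
      module H = Differences H
    open AbelianGroup H using (_≈_; sym; trans)

    Δs-homo : ∀ {M K} (js : Vec (Fin M) K) f x → H.Δs js (λ y → h (f y)) x ≈ h (G.Δs js f x)
    Δs-homo []       f x = AbelianGroup.refl H
    Δs-homo (j ∷ js) f x = trans (H.Δs-cong js (λ y → sym (h-homo-− _ _)) x) (Δs-homo js (G.Δ j f) x)

  module Polynomials {c ℓ} (R : CommutativeRing c ℓ) where

    open CommutativeRing R hiding (zero)
    open Differences +-abelianGroup public
    open import Algebra.Properties.Ring ring using (-‿distribˡ-*; -‿distribʳ-*)
    open import Relation.Binary.Reasoning.Setoid setoid

    -- On the cube, vanishing of all (d+1)-fold differences means being a multilinear polynomial of degree ≤ d.
    DegreeAtMost : ∀ {M} → ℕ → (Vec Bool M → Carrier) → Set ℓ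
    DegreeAtMost zero    f = ∀ j x → Δ j f x ≈ 0#
    DegreeAtMost (suc d) f = ∀ j → DegreeAtMost d (Δ j f)

    ≈-cong : ∀ {A : Set} (f : A → Carrier) {a b} → a ≡ b → f a ≈ f b
    ≈-cong f a≡b = reflexive (≡.cong f a≡b)

    ≈0-* : ∀ {a b} → a ≈ 0# → a * b ≈ 0#
    ≈0-* a≈0 = trans (*-congʳ a≈0) (zeroˡ _)

    *-≈0 : ∀ {a b} → b ≈ 0# → a * b ≈ 0#
    *-≈0 b≈0 = trans (*-congˡ b≈0) (zeroʳ _)

    ∏ : ∀ {M} (m : ℕ) → (Fin m → Vec Bool M → Carrier) → Vec Bool M → Carrier
    ∏ zero    F x = 1#
    ∏ (suc m) F x = F zero x * ∏ m (λ i → F (suc i)) x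

    ∏-zero : ∀ {M} m (F : Fin m → Vec Bool M → Carrier) x i → F i x ≈ 0# → ∏ m F x ≈ 0#
    ∏-zero (suc m) F x zero    Fx≈0 = ≈0-* Fx≈0
    ∏-zero (suc m) F x (suc i) Fx≈0 = *-≈0 (∏-zero m (λ i → F (suc i)) x i Fx≈0)

    Δ-* : ∀ {M} (f g : Vec Bool M → Carrier) j x →
          Δ j (λ y → f y * g y) x ≈ Δ j f x * g (x [ j ]≔ true) + f (x [ j ]≔ false) * Δ j g x
    Δ-* f g j x = sym (begin
      (a₁ - a₀) * b₁ + a₀ * (b₁ - b₀)              ≈⟨ +-cong (distribʳ b₁ a₁ (- a₀)) (distribˡ a₀ b₁ (- b₀)) ⟩
      (a₁ * b₁ + - a₀ * b₁) + (a₀ * b₁ + a₀ * - b₀) ≈⟨ +-cong (+-congˡ (sym (-‿distribˡ-* a₀ b₁)))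
                                                               (+-congˡ (sym (-‿distribʳ-* a₀ b₀))) ⟩
      (a₁ * b₁ - a₀ * b₁) + (a₀ * b₁ - a₀ * b₀)     ≈⟨ +-assoc _ _ _ ⟩
      a₁ * b₁ + (- (a₀ * b₁) + (a₀ * b₁ - a₀ * b₀)) ≈⟨ +-congˡ (sym (+-assoc _ _ _)) ⟩
      a₁ * b₁ + ((- (a₀ * b₁) + a₀ * b₁) - a₀ * b₀) ≈⟨ +-congˡ (+-congʳ (-‿inverseˡ _)) ⟩
      a₁ * b₁ + (0# - a₀ * b₀)                      ≈⟨ +-congˡ (+-identityˡ _) ⟩
      a₁ * b₁ - a₀ * b₀                             ∎)
      where
      a₀ = f (x [ j ]≔ false)
      a₁ = f (x [ j ]≔ true)
      b₀ = g (x [ j ]≔ false)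
      b₁ = g (x [ j ]≔ true)

    module _ {M : ℕ} where

      Δ-restrict-same : ∀ (f : Vec Bool M → Carrier) j b x → Δ j (λ y → f (y [ j ]≔ b)) x ≈ 0#
      Δ-restrict-same f j b x =
        trans (−-cong (≈-cong f ([]≔-idempotent x j)) (≈-cong f ([]≔-idempotent x j))) (x-x≈0 _)

      Δ-restrict-other : ∀ (f : Vec Bool M → Carrier) i j b x → i ≢ j →
                         Δ i (λ y → f (y [ j ]≔ b)) x ≈ Δ i f (x [ j ]≔ b)
      Δ-restrict-other f i j b x i≢j =
        −-cong (≈-cong f ([]≔-commutes x i j i≢j)) (≈-cong f ([]≔-commutes x i j i≢j))

      DegreeAtMost-cong : ∀ {d} {f g : Vec Bool M → Carrier} → (∀ x → f x ≈ g x) → DegreeAtMost d f → DegreeAtMost d g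
      DegreeAtMost-cong {zero}  f≈g deg j x = trans (sym (Δ-cong f≈g j x)) (deg j x)
      DegreeAtMost-cong {suc d} f≈g deg j   = DegreeAtMost-cong {d} (Δ-cong f≈g j) (deg j)

      vanishing-degree : ∀ {d} {f : Vec Bool M → Carrier} → (∀ x → f x ≈ 0#) → DegreeAtMost d f
      vanishing-degree {zero}  f≈0 j x = trans (−-cong (f≈0 _) (f≈0 _)) (x-x≈0 0#)
      vanishing-degree {suc d} f≈0 j   = vanishing-degree {d} (λ x → trans (−-cong (f≈0 _) (f≈0 _)) (x-x≈0 0#))

      const-degree : ∀ {d} k → DegreeAtMost d (λ (_ : Vec Bool M) → k)
      const-degree {zero}  k j x = x-x≈0 k
      const-degree {suc d} k j   = vanishing-degree {d} (λ x → x-x≈0 k)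

      +-degree : ∀ {d} {f g : Vec Bool M → Carrier} → DegreeAtMost d f → DegreeAtMost d g →
                 DegreeAtMost d (λ x → f x + g x)
      +-degree {zero}  {f} {g} df dg j x = trans (Δ-homo-+ f g j x) (trans (+-cong (df j x) (dg j x)) (+-identityˡ 0#))
      +-degree {suc d} {f} {g} df dg j = DegreeAtMost-cong {d} (λ x → sym (Δ-homo-+ f g j x)) (+-degree {d} (df j) (dg j))

      −-degree : ∀ {d} {f g : Vec Bool M → Carrier} → DegreeAtMost d f → DegreeAtMost d g →
                 DegreeAtMost d (λ x → f x - g x)
      −-degree {zero}  {f} {g} df dg j x = trans (Δ-homo-− f g j x) (trans (−-cong (df j x) (dg j x)) (x-x≈0 0#))
      −-degree {suc d} {f} {g} df dg j = DegreeAtMost-cong {d} (λ x → sym (Δ-homo-− f g j x)) (−-degree {d} (df j) (dg j))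

      restrict-degree : ∀ {d} {f : Vec Bool M → Carrier} j b → DegreeAtMost d f →
                        DegreeAtMost d (λ x → f (x [ j ]≔ b))
      restrict-degree {zero} {f} j b df i x with i ≟ j
      ... | yes ≡.refl = Δ-restrict-same f i b x
      ... | no i≢j     = trans (Δ-restrict-other f i j b x i≢j) (df i _)
      restrict-degree {suc d} {f} j b df i with i ≟ j
      ... | yes ≡.refl = vanishing-degree {d} (Δ-restrict-same f i b)
      ... | no i≢j     = DegreeAtMost-cong {d} (λ x → sym (Δ-restrict-other f i j b x i≢j)) (restrict-degree {d} j b (df i))

      *-degree : ∀ {a b} {f g : Vec Bool M → Carrier} → DegreeAtMost a f → DegreeAtMost b g →
                 DegreeAtMost (a ℕ.+ b) (λ x → f x * g x)
      *-degree {zero} {zero} {f} {g} df dg j x =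
        trans (Δ-* f g j x) (trans (+-cong (≈0-* (df j x)) (*-≈0 (dg j x))) (+-identityˡ 0#))
      *-degree {zero} {suc b} {f} {g} df dg j =
        DegreeAtMost-cong {b} (λ x → sym (Δ-* f g j x))
          (+-degree {b} (vanishing-degree {b} (λ x → ≈0-* (df j x)))
                        (*-degree {zero} {b} (restrict-degree {zero} {f} j false df) (dg j)))
      *-degree {suc a} {zero} {f} {g} df dg j =
        DegreeAtMost-cong {a ℕ.+ zero} (λ x → sym (Δ-* f g j x))
          (+-degree {a ℕ.+ zero} (*-degree {a} {zero} (df j) (restrict-degree {zero} {g} j true dg))
                                 (vanishing-degree {a ℕ.+ zero} (λ x → *-≈0 (dg j x))))
      *-degree {suc a} {suc b} {f} {g} df dg j =
        DegreeAtMost-cong {a ℕ.+ suc b} (λ x → sym (Δ-* f g j x))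
          (+-degree {a ℕ.+ suc b} (*-degree {a} {suc b} (df j) (restrict-degree {suc b} {g} j true dg))
            (≡.subst (λ e → DegreeAtMost e (λ x → f (x [ j ]≔ false) * Δ j g x)) (≡.sym (+-suc a b))
                     (*-degree {suc a} {b} {λ x → f (x [ j ]≔ false)} (restrict-degree {suc a} {f} j false df) (dg j))))

      ∏-degree : ∀ m (d : Fin m → ℕ) (F : Fin m → Vec Bool M → Carrier) →
                 (∀ i → DegreeAtMost (d i) (F i)) → DegreeAtMost (Σ[< m ] d) (∏ m F)
      ∏-degree zero    d F dF = const-degree {0} 1#
      ∏-degree (suc m) d F dF =
        *-degree {d zero} (dF zero) (∏-degree m (λ i → d (suc i)) (λ i → F (suc i)) (λ i → dF (suc i)))

      lookup-degree : ∀ (φ : Bool → Carrier) v → DegreeAtMost 1 (λ x → φ (lookup x v))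
      lookup-degree φ v j with j ≟ v
      ... | yes ≡.refl = DegreeAtMost-cong {0}
        (λ x → sym (−-cong (≈-cong φ (lookup∘update j x true)) (≈-cong φ (lookup∘update j x false))))
        (const-degree {0} (φ true - φ false))
      ... | no j≢v = vanishing-degree {0} (λ x →
        trans (−-cong (≈-cong φ (lookup∘update′ (j≢v ∘ ≡.sym) x true)) (≈-cong φ (lookup∘update′ (j≢v ∘ ≡.sym) x false)))
              (x-x≈0 _))

      DegreeAtMost-fromΔs : ∀ d (f : Vec Bool M → Carrier) →
                            (∀ (js : Vec (Fin M) (suc d)) x → Δs js f x ≈ 0#) → DegreeAtMost d f
      DegreeAtMost-fromΔs zero    f Δs≈0 j x = Δs≈0 (j ∷ []) x
      DegreeAtMost-fromΔs (suc d) f Δs≈0 j   = DegreeAtMost-fromΔs d (Δ j f) (λ js → Δs≈0 (j ∷ js))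

    tail-degree : ∀ {M d} {g : Vec Bool (suc M) → Carrier} b → DegreeAtMost d g →
                  DegreeAtMost d (λ x → g (b ∷ x))
    tail-degree {d = zero}  b dg j x = dg (suc j) (b ∷ x)
    tail-degree {d = suc d} b dg j   = tail-degree {d = d} b (dg (suc j))

    alternatingSum-degree< : ∀ M {d} {f : Vec Bool M → Carrier} → DegreeAtMost d f → d < M →
                             alternatingSum M f ≈ 0#
    alternatingSum-degree< (suc M) {zero} df _ =
      trans (sym (alternatingSum-homo-− M _ _)) (alternatingSum-zero M (λ c → df zero (false ∷ c)))
    alternatingSum-degree< (suc M) {suc d} df (s≤s d<M) =
      trans (sym (alternatingSum-homo-− M _ _))
            (alternatingSum-degree< M {d} (tail-degree {d = d} false (df zero)) d<M)

module Terms (σ : Signature) where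

  open import Relation.Binary.PropositionalEquality

  rename : {V W : Set} → (V → W) → Term σ V → Term σ W
  rename r (var v)    = var (r v)
  rename r (plus t u) = plus (rename r t) (rename r u)
  rename r (neg t)    = neg (rename r t)
  rename r zer        = zer
  rename r (app j ts) = app j (λ i → rename r (ts i))

  module Evaluation (B : Algebra σ) (op-cong : ∀ j {u v} → (∀ i → u i ≡ v i) → Algebra.op B j u ≡ Algebra.op B j v) where
    open Algebra B

    eval-cong : {V : Set} (t : Term σ V) {ρ ρ′ : V → Carrier} → (∀ v → ρ v ≡ ρ′ v) → eval σ B t ρ ≡ eval σ B t ρ′
    eval-cong (var v)    ρ≡ρ′ = ρ≡ρ′ v
    eval-cong (plus t u) ρ≡ρ′ = cong₂ _⊕_ (eval-cong t ρ≡ρ′) (eval-cong u ρ≡ρ′)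
    eval-cong (neg t)    ρ≡ρ′ = cong ⊖_ (eval-cong t ρ≡ρ′)
    eval-cong zer        ρ≡ρ′ = refl
    eval-cong (app j ts) ρ≡ρ′ = op-cong j (λ i → eval-cong (ts i) ρ≡ρ′)

    eval-rename : {V W : Set} (r : V → W) (t : Term σ V) (ρ : W → Carrier) →
                  eval σ B (rename r t) ρ ≡ eval σ B t (λ v → ρ (r v))
    eval-rename r (var v)    ρ = refl
    eval-rename r (plus t u) ρ = cong₂ _⊕_ (eval-rename r t ρ) (eval-rename r u ρ)
    eval-rename r (neg t)    ρ = cong ⊖_ (eval-rename r t ρ)
    eval-rename r zer        ρ = refl
    eval-rename r (app j ts) ρ = op-cong j (λ i → eval-rename r (ts i) ρ)

module Supernilpotent (σ : Signature) (B : Algebra σ)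
  (isAbelianGroup : IsAbelianGroup _≡_ (Algebra._⊕_ B) (Algebra.𝟎 B) (Algebra.⊖_ B))
  (op-cong : ∀ j {u v} → (∀ i → u i ≡ v i) → Algebra.op B j u ≡ Algebra.op B j v)
  (k : ℕ) (C-total : C σ B k (λ _ → 𝟏ᶜ σ B) (𝟏ᶜ σ B) (Δᶜ σ B))
  where

  open import Data.Nat using (zero; _+_)
  open import Data.Fin using (zero; suc; _↑ˡ_; _↑ʳ_; splitAt; _≟_)
  open import Data.Fin.Properties using (splitAt-↑ˡ; splitAt-↑ʳ; ¬∀⟶∃¬)
  open import Data.Vec using (Vec; []; _∷_; lookup; _[_]≔_)
  open import Data.Vec.Properties using (lookup∘update′)
  open import Data.Bool using (Bool; true; false; if_then_else_)
  open import Data.Bool.Properties using (¬-not)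
  import Data.Bool as Bool
  open import Data.Maybe using (Maybe; just; nothing; maybe′; fromMaybe)
  open import Data.Product using (Σ; _,_; _×_)
  open import Data.Sum using (inj₁; inj₂; [_,_]′)
  open import Data.Unit using (tt)
  open import Relation.Binary.PropositionalEquality
  open import Relation.Nullary using (yes; no)
  open import Function.Bundles using (Inverse)
  open import Algebra.Bundles using (AbelianGroup)
  open import Level using (0ℓ)
  open BooleanCube using (updateAll; firstIndexOf; lookup-updateAll; module Differences)

  open Algebra B
  open Terms σ
  open Evaluation B op-cong

  abelianGroup : AbelianGroup 0ℓ 0ℓ
  abelianGroup = record { isAbelianGroup = isAbelianGroup }

  open AbelianGroup abelianGroup using (_-_)
  open Differences abelianGroup public

  alternatingSumTerm : {V : Set} (K : ℕ) → (Vec Bool K → Term σ V) → Term σ V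
  alternatingSumTerm zero    τ = τ []
  alternatingSumTerm (suc K) τ =
    plus (alternatingSumTerm K (λ c → τ (true ∷ c))) (neg (alternatingSumTerm K (λ c → τ (false ∷ c))))

  eval-alternatingSumTerm : {V : Set} (K : ℕ) (τ : Vec Bool K → Term σ V) (ρ : V → Carrier) →
                            eval σ B (alternatingSumTerm K τ) ρ ≡ alternatingSum K (λ c → eval σ B (τ c) ρ)
  eval-alternatingSumTerm zero    τ ρ = refl
  eval-alternatingSumTerm (suc K) τ ρ = cong₂ _-_ (eval-alternatingSumTerm K _ ρ) (eval-alternatingSumTerm K _ ρ)

  module _ {m N : ℕ} (t : Term σ (Fin (suc k) × Fin m ⊎ Fin N))
           (ρ : Bool → Fin (suc k) → Fin m → Carrier) (κ : Fin N → Carrier) where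

    blockEnv : Vec Bool (suc k) → Fin (suc k) × Fin m ⊎ Fin N → Carrier
    blockEnv c = [ (λ { (i , v) → ρ (lookup c i) i v }) , κ ]′

    blockValue : Vec Bool (suc k) → Carrier
    blockValue c = eval σ B t (blockEnv c)

    -- T has two copies of each block i > 0: the first is the block of the commutator condition, the second
    -- is frozen at ρ false.  The summand of T at c reads block i from its first copy exactly when c i is true.
    private
      VarT : Set
      VarT = Σ (Fin k) (λ _ → Fin (m + m)) ⊎ Fin (m + N)

      switch : Vec Bool k → Fin (suc k) × Fin m ⊎ Fin N → VarT
      switch c (inj₁ (zero , v))  = inj₂ (v ↑ˡ N)
      switch c (inj₁ (suc i , v)) = inj₁ (i , (if lookup c i then v ↑ˡ m else m ↑ʳ v))
      switch c (inj₂ w)           = inj₂ (m ↑ʳ w)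

      T : Term σ VarT
      T = alternatingSumTerm k (λ c → rename (switch c) t)

      choice : Bool → Fin k → Fin (m + m) → Carrier
      choice b i w = [ ρ b (suc i) , ρ false (suc i) ]′ (splitAt m w)

      last : Bool → Fin (m + N) → Carrier
      last e w = [ ρ e zero , κ ]′ (splitAt m w)

      E : (Fin k → Bool) → Bool → VarT → Carrier
      E c′ e = env σ B (choice false) (choice true) c′ (last e)

      E-switch-independent : ∀ c′ i → c′ i ≡ false → ∀ e c b x →
                             E c′ e (switch c x) ≡ E c′ e (switch (c [ i ]≔ b) x)
      E-switch-independent c′ i c′i≡false e c b (inj₁ (zero , v)) = refl
      E-switch-independent c′ i c′i≡false e c b (inj₁ (suc i′ , v)) with i′ ≟ i
      ... | yes refl rewrite c′i≡false = trans (choice-false (lookup c i′)) (sym (choice-false (lookup (c [ i′ ]≔ b) i′)))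
        where
        choice-false : ∀ b′ → choice false i′ (if b′ then v ↑ˡ m else m ↑ʳ v) ≡ ρ false (suc i′) v
        choice-false true  rewrite splitAt-↑ˡ m v m = refl
        choice-false false rewrite splitAt-↑ʳ m m v = refl
      ... | no i′≢i rewrite lookup∘update′ i′≢i c b = refl
      E-switch-independent c′ i c′i≡false e c b (inj₂ w) = refl

      T-vanishes : ∀ c′ i → c′ i ≡ false → ∀ e → eval σ B T (E c′ e) ≡ 𝟎
      T-vanishes c′ i c′i≡false e = trans (eval-alternatingSumTerm k _ (E c′ e))
        (alternatingSum-constantIn k i _ (λ c b →
          trans (eval-rename _ t _)
                (trans (eval-cong t (λ x → E-switch-independent c′ i c′i≡false e c b x))
                       (sym (eval-rename _ t _)))))

      E-all-true : ∀ e c x → E (λ _ → true) e (switch c x) ≡ blockEnv (e ∷ c) x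
      E-all-true e c (inj₁ (zero , v)) rewrite splitAt-↑ˡ m v N = refl
      E-all-true e c (inj₁ (suc i , v)) with lookup c i
      ... | true  rewrite splitAt-↑ˡ m v m = refl
      ... | false rewrite splitAt-↑ʳ m m v = refl
      E-all-true e c (inj₂ w) rewrite splitAt-↑ʳ m N w = refl

      T-all-true : ∀ e → eval σ B T (E (λ _ → true) e) ≡ alternatingSum k (λ c → blockValue (e ∷ c))
      T-all-true e = trans (eval-alternatingSumTerm k _ _)
        (alternatingSum-cong k (λ c → trans (eval-rename _ t _) (eval-cong t (E-all-true e c))))

    -- T vanishes unless every block i > 0 takes its second value, so C(1,…,1;0) makes T independent of block 0.
    alternatingSum-blockValue : alternatingSum (suc k) blockValue ≡ 𝟎
    alternatingSum-blockValue = begin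
      alternatingSum (suc k) blockValue
        ≡⟨ cong₂ _-_ (sym (T-all-true true)) (sym (T-all-true false)) ⟩
      eval σ B T (E (λ _ → true) true) - eval σ B T (E (λ _ → true) false)
        ≡⟨ cong (_- eval σ B T (E (λ _ → true) false)) (sym last-block-irrelevant) ⟩
      eval σ B T (E (λ _ → true) false) - eval σ B T (E (λ _ → true) false)
        ≡⟨ x-x≈0 _ ⟩
      𝟎 ∎
      where
      open ≡-Reasoning
      last-block-irrelevant : eval σ B T (E (λ _ → true) false) ≡ eval σ B T (E (λ _ → true) true)
      last-block-irrelevant = C-total (λ _ → m + m) (m + N) T (choice false) (choice true) (last false) (last true)
        (λ _ _ → tt) (λ _ → tt)
        (λ c′ not-all-true → let (i , c′i≢true) = ¬∀⟶∃¬ k _ (λ i → c′ i Bool.≟ true) not-all-true in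
           trans (T-vanishes c′ i (¬-not c′i≢true) false) (sym (T-vanishes c′ i (¬-not c′i≢true) true)))

  module _ {N : ℕ} (card : Carrier ↔ Fin N) {n : ℕ} {W : Set}
           (u : Term σ (Fin n ⊎ W)) (κ : W → Carrier) (Y : Fin n → Bool → Carrier) where

    cubePolynomial : Vec Bool n → Carrier
    cubePolynomial x = eval σ B u [ (λ v → Y v (lookup x v)) , κ ]′

    -- A variable v of u goes to the block of its first position in js (block zero if it has none, where both
    -- values agree); the constants are renamed to Fin N through card, as C only allows finitely many.
    Δs-cubePolynomial : ∀ (js : Vec (Fin n) (suc k)) x → Δs js cubePolynomial x ≡ 𝟎
    Δs-cubePolynomial js x = begin
      Δs js cubePolynomial x                                        ≡⟨ Δs≈alternatingSum js cubePolynomial x ⟩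
      alternatingSum (suc k) (λ c → cubePolynomial (updateAll js c x)) ≡⟨ alternatingSum-cong (suc k) as-blockValue ⟩
      alternatingSum (suc k) (blockValue t ρ (Inverse.from card))   ≡⟨ alternatingSum-blockValue t ρ (Inverse.from card) ⟩
      𝟎                                                             ∎
      where
      open ≡-Reasoning
      position : Fin n → Maybe (Fin (suc k))
      position v = firstIndexOf v js

      toBlocks : Fin n ⊎ W → Fin (suc k) × Fin n ⊎ Fin N
      toBlocks = [ (λ v → inj₁ (fromMaybe zero (position v) , v)) , (λ w → inj₂ (Inverse.to card (κ w))) ]′

      t : Term σ (Fin (suc k) × Fin n ⊎ Fin N)
      t = rename toBlocks u

      ρ : Bool → Fin (suc k) → Fin n → Carrier
      ρ b _ v = Y v (maybe′ (λ _ → b) (lookup x v) (position v))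

      same-value : ∀ c y → [ (λ v → Y v (lookup (updateAll js c x) v)) , κ ]′ y ≡
                           blockEnv t ρ (Inverse.from card) c (toBlocks y)
      same-value c (inj₁ v) rewrite lookup-updateAll js c x v with position v
      ... | just i  = refl
      ... | nothing = refl
      same-value c (inj₂ w) = sym (Inverse.strictlyInverseʳ card (κ w))

      as-blockValue : ∀ c → cubePolynomial (updateAll js c x) ≡ blockValue t ρ (Inverse.from card) c
      as-blockValue c = trans (eval-cong u (same-value c)) (sym (eval-rename _ u _))

module ElementaryAbelianBasis (σ : Signature) (B : Algebra σ)
  (isAbelianGroup : IsAbelianGroup _≡_ (Algebra._⊕_ B) (Algebra.𝟎 B) (Algebra.⊖_ B))
  {q : ℕ} (q-prime : Prime q) (q·≡𝟎 : ∀ x → _·_ σ {B} q x ≡ Algebra.𝟎 B)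
  where

  open import Data.Nat as ℕ using (zero; _+_; _*_; _∸_; _≤_; _<_; NonZero)
  import Data.Nat.Properties as ℕ
  open import Data.Nat.DivMod using (_%_; _/_; m%n<n; m≡m%n+[m/n]*n)
  open import Data.Nat.Primality using (prime⇒irreducible; prime⇒nonZero; prime⇒nonTrivial)
  open import Data.Nat.Coprimality using (Coprime; coprime-Bézout)
  open import Data.Nat.GCD using (module Bézout)
  open import Data.Nat.Divisibility using (∣⇒≤)
  open import Data.Nat.Induction using (<-wellFounded)
  open import Induction.WellFounded using (Acc; acc)
  open import Data.Fin as Fin using (zero; suc; toℕ; fromℕ<)
  import Data.Fin.Properties as Fin
  open import Data.Fin.Permutation using (↔⇒≡)
  open import Data.Vec using (Vec; []; _∷_; lookup; map; zipWith)
  open import Data.Vec.Properties using (lookup-map; lookup-zipWith)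
  open import Data.Vec.Relation.Binary.Pointwise.Extensional using (ext; Pointwise-≡⇒≡)
  open import Data.Product using (∃; _,_; proj₁; proj₂; uncurry)
  open import Data.Product.Function.NonDependent.Propositional using (_×-↔_)
  open import Data.Sum using (inj₁; inj₂)
  open import Relation.Binary.PropositionalEquality
  open import Relation.Nullary using (Dec; yes; no; ¬_; contradiction; map′)
  open import Relation.Binary.Definitions using (tri<; tri≈; tri>)
  open import Function.Bundles using (Inverse; Injection; mk↔ₛ′)
  open import Function.Properties.Inverse using (↔-refl; ↔-trans; Inverse⇒Injection)
  open import Algebra.Bundles using (AbelianGroup)
  open import Level using (0ℓ)

  open Algebra B

  abelianGroup : AbelianGroup 0ℓ 0ℓ
  abelianGroup = record { isAbelianGroup = isAbelianGroup }

  open AbelianGroup abelianGroup using (assoc; identityˡ; identityʳ; inverseʳ; monoid; commutativeMonoid; group)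
  open import Algebra.Properties.Monoid.Mult monoid using (_×_; ×-homo-+; ×-assocˡ)
  open import Algebra.Properties.CommutativeMonoid.Mult commutativeMonoid using (×-distrib-+)
  open import Algebra.Properties.CommutativeSemigroup (AbelianGroup.commutativeSemigroup abelianGroup) using (interchange)
  open import Algebra.Properties.Group group using (∙-cancelˡ; inverseˡ-unique; inverseʳ-unique)

  instance
    q-nonZero : NonZero q
    q-nonZero = prime⇒nonZero q-prime

  ·≡× : ∀ m x → _·_ σ {B} m x ≡ m × x
  ·≡× zero    x = refl
  ·≡× (suc m) x = cong (x ⊕_) (·≡× m x)

  q×≡𝟎 : ∀ x → q × x ≡ 𝟎
  q×≡𝟎 x = trans (sym (·≡× q x)) (q·≡𝟎 x)

  ×𝟎 : ∀ m → m × 𝟎 ≡ 𝟎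
  ×𝟎 zero    = refl
  ×𝟎 (suc m) = trans (identityˡ _) (×𝟎 m)

  [m*q]×≡𝟎 : ∀ m x → (m * q) × x ≡ 𝟎
  [m*q]×≡𝟎 m x = trans (sym (×-assocˡ x m q)) (trans (cong (m ×_) (q×≡𝟎 x)) (×𝟎 m))

  %-× : ∀ m x → (m % q) × x ≡ m × x
  %-× m x = begin
    (m % q) × x                          ≡⟨ sym (identityʳ _) ⟩
    ((m % q) × x) ⊕ 𝟎                    ≡⟨ cong (((m % q) × x) ⊕_) (sym ([m*q]×≡𝟎 (m / q) x)) ⟩
    ((m % q) × x) ⊕ ((m / q * q) × x)     ≡⟨ sym (×-homo-+ x (m % q) _) ⟩
    (m % q + m / q * q) × x               ≡⟨ cong (_× x) (sym (m≡m%n+[m/n]*n m q)) ⟩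
    m × x                                ∎
    where open ≡-Reasoning

  ⊖≡[q∸1]× : ∀ x → ⊖ x ≡ (q ∸ 1) × x
  ⊖≡[q∸1]× x = sym (inverseʳ-unique x _ (trans (cong (_× x) (ℕ.suc-pred q)) (q×≡𝟎 x)))

  linN : ∀ {j} → Vec Carrier j → Vec ℕ j → Carrier
  linN []       []       = 𝟎
  linN (e ∷ es) (a ∷ ns) = (a × e) ⊕ linN es ns

  lin : ∀ {j} → Vec Carrier j → Vec (Fin q) j → Carrier
  lin es v = linN es (map toℕ v)

  residue : ℕ → Fin q
  residue m = fromℕ< (m%n<n m q)

  lin-residue : ∀ {j} (es : Vec Carrier j) ns → lin es (map residue ns) ≡ linN es ns
  lin-residue []       []       = refl
  lin-residue (e ∷ es) (a ∷ ns) =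
    cong₂ _⊕_ (trans (cong (_× e) (Fin.toℕ-fromℕ< (m%n<n a q))) (%-× a e)) (lin-residue es ns)

  linN-homo-+ : ∀ {j} (es : Vec Carrier j) ns ms → linN es (zipWith _+_ ns ms) ≡ linN es ns ⊕ linN es ms
  linN-homo-+ []       []       []       = sym (identityˡ 𝟎)
  linN-homo-+ (e ∷ es) (a ∷ ns) (b ∷ ms) =
    trans (cong₂ _⊕_ (×-homo-+ e a b) (linN-homo-+ es ns ms)) (interchange (a × e) (b × e) (linN es ns) (linN es ms))

  linN-homo-× : ∀ {j} (es : Vec Carrier j) c ns → linN es (map (c *_) ns) ≡ c × linN es ns
  linN-homo-× []       c []       = sym (×𝟎 c)
  linN-homo-× (e ∷ es) c (a ∷ ns) =
    trans (cong₂ _⊕_ (sym (×-assocˡ e c a)) (linN-homo-× es c ns)) (sym (×-distrib-+ _ _ c))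

  infix 4 _∈Span_

  _∈Span_ : ∀ {j} → Carrier → Vec Carrier j → Set
  b ∈Span es = ∃ λ ns → linN es ns ≡ b

  module _ {j} {es : Vec Carrier j} where

    ∈Span-⊕ : ∀ {x y} → x ∈Span es → y ∈Span es → (x ⊕ y) ∈Span es
    ∈Span-⊕ (ns , refl) (ms , refl) = zipWith _+_ ns ms , linN-homo-+ es ns ms

    ∈Span-× : ∀ c {x} → x ∈Span es → (c × x) ∈Span es
    ∈Span-× c (ns , refl) = map (c *_) ns , linN-homo-× es c ns

    ∈Span-⊖ : ∀ {x} → x ∈Span es → (⊖ x) ∈Span es
    ∈Span-⊖ {x} x∈ = subst (_∈Span es) (sym (⊖≡[q∸1]× x)) (∈Span-× (q ∸ 1) x∈)

    -- d is invertible modulo the prime q: by Bézout, x d = 1 + y q or 1 + x d = y q.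
    ∈Span-unscale : ∀ {d b} → 0 < d → d < q → (d × b) ∈Span es → b ∈Span es
    ∈Span-unscale {d} {b} 0<d d<q db∈ with coprime-Bézout d-coprime
      where
      d-coprime : Coprime d q
      d-coprime {i} (i∣d , i∣q) with prime⇒irreducible q-prime i∣q
      ... | inj₁ i≡1    = i≡1
      ... | inj₂ refl   = contradiction (∣⇒≤ {{ℕ.>-nonZero 0<d}} i∣d) (ℕ.<⇒≱ d<q)
    ... | Bézout.Identity.+- x y 1+yq≡xd = subst (_∈Span es) x[db]≡b (∈Span-× x db∈)
      where
      x[db]≡b : x × (d × b) ≡ b
      x[db]≡b = begin
        x × (d × b)          ≡⟨ ×-assocˡ b x d ⟩
        (x * d) × b          ≡⟨ cong (_× b) (sym 1+yq≡xd) ⟩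
        b ⊕ ((y * q) × b)    ≡⟨ cong (b ⊕_) ([m*q]×≡𝟎 y b) ⟩
        b ⊕ 𝟎                ≡⟨ identityʳ b ⟩
        b                    ∎
        where open ≡-Reasoning
    ... | Bézout.Identity.-+ x y 1+xd≡yq = subst (_∈Span es) ⊖[x[db]]≡b (∈Span-⊖ (∈Span-× x db∈))
      where
      ⊖[x[db]]≡b : ⊖ (x × (d × b)) ≡ b
      ⊖[x[db]]≡b = sym (trans (inverseˡ-unique b _ (trans (cong (_× b) 1+xd≡yq) ([m*q]×≡𝟎 y b)))
                              (cong ⊖_ (sym (×-assocˡ b x d))))

    ∈Span-fromRelation : ∀ {b x x′ L W} → x′ < x → x < q → (x × b) ⊕ L ≡ (x′ × b) ⊕ W →
                         L ∈Span es → W ∈Span es → b ∈Span es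
    ∈Span-fromRelation {b} {x} {x′} {L} {W} x′<x x<q relation L∈ W∈ =
      ∈Span-unscale (ℕ.m<n⇒0<n∸m x′<x) (ℕ.≤-<-trans (ℕ.m∸n≤m x x′) x<q)
        (subst (_∈Span es) (sym y≡W⊖L) (∈Span-⊕ W∈ (∈Span-⊖ L∈)))
      where
      open ≡-Reasoning
      y : Carrier
      y = (x ∸ x′) × b
      y⊕L≡W : y ⊕ L ≡ W
      y⊕L≡W = ∙-cancelˡ (x′ × b) _ _ (begin
        (x′ × b) ⊕ (y ⊕ L)          ≡⟨ sym (assoc _ _ _) ⟩
        ((x′ × b) ⊕ y) ⊕ L          ≡⟨ cong (_⊕ L) (sym (×-homo-+ b x′ (x ∸ x′))) ⟩
        ((x′ + (x ∸ x′)) × b) ⊕ L   ≡⟨ cong (λ z → (z × b) ⊕ L) (ℕ.m+[n∸m]≡n (ℕ.<⇒≤ x′<x)) ⟩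
        (x × b) ⊕ L                 ≡⟨ relation ⟩
        (x′ × b) ⊕ W                ∎)
      y≡W⊖L : y ≡ W ⊕ (⊖ L)
      y≡W⊖L = begin
        y                  ≡⟨ sym (identityʳ y) ⟩
        y ⊕ 𝟎              ≡⟨ cong (y ⊕_) (sym (inverseʳ L)) ⟩
        y ⊕ (L ⊕ (⊖ L))    ≡⟨ sym (assoc _ _ _) ⟩
        (y ⊕ L) ⊕ (⊖ L)    ≡⟨ cong (_⊕ (⊖ L)) y⊕L≡W ⟩
        W ⊕ (⊖ L)          ∎

  Independent : ∀ {j} → Vec Carrier j → Set
  Independent es = ∀ v w → lin es v ≡ lin es w → v ≡ w

  Independent-∷ : ∀ {j} {es : Vec Carrier j} {b} → Independent es → ¬ b ∈Span es → Independent (b ∷ es)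
  Independent-∷ {es = es} {b} indep b∉ (a ∷ v) (a′ ∷ w) relation with ℕ.<-cmp (toℕ a) (toℕ a′)
  ... | tri< a<a′ _ _ = contradiction
    (∈Span-fromRelation {es = es} a<a′ (Fin.toℕ<n a′) (sym relation) (map toℕ w , refl) (map toℕ v , refl)) b∉
  ... | tri> _ _ a′<a = contradiction
    (∈Span-fromRelation {es = es} a′<a (Fin.toℕ<n a) relation (map toℕ v , refl) (map toℕ w , refl)) b∉
  ... | tri≈ _ a≡a′ _ with Fin.toℕ-injective a≡a′
  ... | refl = cong (a ∷_) (indep v w (∙-cancelˡ _ _ _ relation))

  Fin^↔Vec : ∀ j → Fin (q ^ j) ↔ Vec (Fin q) j
  Fin^↔Vec zero    = mk↔ₛ′ (λ _ → []) (λ _ → zero) (λ { [] → refl }) (λ { zero → refl })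
  Fin^↔Vec (suc j) = ↔-trans Fin.*↔× (↔-trans (↔-refl ×-↔ Fin^↔Vec j) pair↔∷)
    where
    pair↔∷ : (Fin q Data.Product.× Vec (Fin q) j) ↔ Vec (Fin q) (suc j)
    pair↔∷ = mk↔ₛ′ (uncurry _∷_) (λ { (a ∷ v) → a , v }) (λ { (a ∷ v) → refl }) (λ _ → refl)

  module Coordinates {N : ℕ} (card : Carrier ↔ Fin N) where

    open Inverse card using (to; from; strictlyInverseˡ; strictlyInverseʳ)

    _≟_ : (x y : Carrier) → Dec (x ≡ y)
    _≟_ = ↔Fin-deq card

    _∈Span?_ : ∀ {j} b (es : Vec Carrier j) → Dec (b ∈Span es)
    _∈Span?_ {j} b es =
      map′ (λ (i , eq) → map toℕ (enumerate i) , eq)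
           (λ (ns , eq) → Inverse.from (Fin^↔Vec j) (map residue ns) ,
                          trans (cong (lin es) (Inverse.strictlyInverseˡ (Fin^↔Vec j) _)) (trans (lin-residue es ns) eq))
           (Fin.any? (λ i → lin es (enumerate i) ≟ b))
      where
      enumerate : Fin (q ^ j) → Vec (Fin q) j
      enumerate = Inverse.to (Fin^↔Vec j)

    Independent⇒q^j≤N : ∀ {j} {es : Vec Carrier j} → Independent es → q ^ j ≤ N
    Independent⇒q^j≤N {j} {es} indep = Fin.injective⇒≤ {f = λ i → to (lin es (Inverse.to (Fin^↔Vec j) i))}
      (λ eq → ↔-injective (Fin^↔Vec j) (indep _ _ (↔-injective card eq)))
      where
      ↔-injective : ∀ {A B : Set} (e : A ↔ B) {x y} → Inverse.to e x ≡ Inverse.to e y → x ≡ y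
      ↔-injective e = Injection.injective (Inverse⇒Injection e)

    record Basis : Set where
      field
        dim         : ℕ
        vectors     : Vec Carrier dim
        independent : Independent vectors
        spanning    : ∀ b → b ∈Span vectors

    private
      extend : ∀ {j} (es : Vec Carrier j) → Independent es → Acc _<_ (N ∸ q ^ j) → Basis
      extend {j} es indep (acc smaller) with Fin.all? (λ f → from f ∈Span? es)
      ... | yes all-spanned = record
        { dim = j ; vectors = es ; independent = indep
        ; spanning = λ b → subst (_∈Span es) (strictlyInverseʳ b) (all-spanned (to b)) }
      ... | no ¬all-spanned with Fin.¬∀⟶∃¬ N _ (λ f → from f ∈Span? es) ¬all-spanned
      ... | f , f∉ = extend (from f ∷ es) indep′ (smaller (ℕ.∸-monoʳ-< q^j<q^[1+j] (Independent⇒q^j≤N {es = from f ∷ es} indep′)))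
        where
        indep′ : Independent (from f ∷ es)
        indep′ = Independent-∷ indep f∉
        q^j<q^[1+j] : q ^ j < q ^ suc j
        q^j<q^[1+j] = ℕ.^-monoʳ-< q (ℕ.nonTrivial⇒n>1 q {{prime⇒nonTrivial q-prime}}) (ℕ.n<1+n j)

    -- Opaque because only its fields matter: unfolding the search makes type checking very slow.
    opaque
      basis : Basis
      basis = extend [] (λ { [] [] _ → refl }) (<-wellFounded _)

    open Basis basis public using (dim)
    open Basis basis using (vectors; independent; spanning)

    coordinates : Carrier → Vec (Fin q) dim
    coordinates x = map residue (proj₁ (spanning x))

    lin-coordinates : ∀ x → lin vectors (coordinates x) ≡ x
    lin-coordinates x = trans (lin-residue vectors _) (proj₂ (spanning x))

    coordinate : Fin dim → Carrier → Fin q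
    coordinate i x = lookup (coordinates x) i

    coordinate-injective : ∀ {x y} → (∀ i → coordinate i x ≡ coordinate i y) → x ≡ y
    coordinate-injective {x} {y} same = begin
      x                          ≡⟨ sym (lin-coordinates x) ⟩
      lin vectors (coordinates x) ≡⟨ cong (lin vectors) (Pointwise-≡⇒≡ (ext same)) ⟩
      lin vectors (coordinates y) ≡⟨ lin-coordinates y ⟩
      y                          ∎
      where open ≡-Reasoning

    coordinate-homo-⊕ : ∀ i x y → toℕ (coordinate i (x ⊕ y)) ≡ (toℕ (coordinate i x) + toℕ (coordinate i y)) % q
    coordinate-homo-⊕ i x y = begin
      toℕ (lookup (coordinates (x ⊕ y)) i)   ≡⟨ cong (λ v → toℕ (lookup v i)) coordinates-⊕ ⟩
      toℕ (lookup (map residue sum) i)      ≡⟨ cong toℕ (lookup-map i residue sum) ⟩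
      toℕ (residue (lookup sum i))          ≡⟨ Fin.toℕ-fromℕ< _ ⟩
      lookup sum i % q                      ≡⟨ cong (_% q) (lookup-zipWith _+_ i (map toℕ (coordinates x)) (map toℕ (coordinates y))) ⟩
      (lookup (map toℕ (coordinates x)) i + lookup (map toℕ (coordinates y)) i) % q
        ≡⟨ cong₂ (λ a b → (a + b) % q) (lookup-map i toℕ (coordinates x)) (lookup-map i toℕ (coordinates y)) ⟩
      (toℕ (coordinate i x) + toℕ (coordinate i y)) % q ∎
      where
      open ≡-Reasoning
      sum : Vec ℕ dim
      sum = zipWith _+_ (map toℕ (coordinates x)) (map toℕ (coordinates y))
      coordinates-⊕ : coordinates (x ⊕ y) ≡ map residue sum
      coordinates-⊕ = independent _ _ (begin
        lin vectors (coordinates (x ⊕ y))            ≡⟨ lin-coordinates (x ⊕ y) ⟩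
        x ⊕ y                                        ≡⟨ sym (cong₂ _⊕_ (lin-coordinates x) (lin-coordinates y)) ⟩
        lin vectors (coordinates x) ⊕ lin vectors (coordinates y) ≡⟨ sym (linN-homo-+ vectors _ _) ⟩
        linN vectors sum                             ≡⟨ sym (lin-residue vectors sum) ⟩
        lin vectors (map residue sum)                ∎)

    q^dim≡N : q ^ dim ≡ N
    q^dim≡N = ↔⇒≡ (↔-trans (Fin^↔Vec dim) (↔-trans vectors↔ card))
      where
      vectors↔ : Vec (Fin q) dim ↔ Carrier
      vectors↔ = mk↔ₛ′ (lin vectors) coordinates lin-coordinates
                       (λ v → independent _ _ (lin-coordinates (lin vectors v)))

module PrimePowers where

  open import Data.Nat as ℕ using (zero; _*_; _∸_; _<_)
  import Data.Nat.Properties as ℕ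
  open import Data.Nat.Primality using (euclidsLemma; prime⇒irreducible; prime⇒nonTrivial)
  open import Data.Nat.Divisibility using (_∣_; divides; ∣1⇒≡1)
  open import Data.Sum using (inj₁; inj₂)
  open import Relation.Binary.PropositionalEquality
  open import Relation.Binary.Definitions using (tri<; tri≈; tri>)
  open import Relation.Nullary using (contradiction)

  private
    1<prime : ∀ {p} → Prime p → 1 < p
    1<prime {p} p-prime = ℕ.nonTrivial⇒n>1 p {{prime⇒nonTrivial p-prime}}

    prime≢1 : ∀ {p} → Prime p → p ≢ 1
    prime≢1 p-prime refl = contradiction (1<prime p-prime) (ℕ.<-irrefl refl)

  prime∣m^n⇒∣m : ∀ {m q} → Prime q → ∀ n → q ∣ m ^ n → q ∣ m
  prime∣m^n⇒∣m q-prime zero    q∣1 = contradiction (∣1⇒≡1 q∣1) (prime≢1 q-prime)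
  prime∣m^n⇒∣m q-prime (suc n) q∣m^[1+n] with euclidsLemma _ _ q-prime q∣m^[1+n]
  ... | inj₁ q∣m   = q∣m
  ... | inj₂ q∣m^n = prime∣m^n⇒∣m q-prime n q∣m^n

  ^-injectiveʳ : ∀ {p} → 1 < p → ∀ {a b} → p ^ a ≡ p ^ b → a ≡ b
  ^-injectiveʳ {p} 1<p {a} {b} p^a≡p^b with ℕ.<-cmp a b
  ... | tri< a<b _ _ = contradiction p^a≡p^b (ℕ.<⇒≢ (ℕ.^-monoʳ-< p 1<p a<b))
  ... | tri≈ _ a≡b _ = a≡b
  ... | tri> _ _ b<a = contradiction (sym p^a≡p^b) (ℕ.<⇒≢ (ℕ.^-monoʳ-< p 1<p b<a))

  q^j≡p^α⇒j*[q∸1]≡α*[p∸1] : ∀ {p q} j α → Prime p → Prime q → q ^ j ≡ p ^ α → j * (q ∸ 1) ≡ α * (p ∸ 1)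
  q^j≡p^α⇒j*[q∸1]≡α*[p∸1] {p} zero α p-prime q-prime 1≡p^α = cong (_* (p ∸ 1)) (^-injectiveʳ (1<prime p-prime) {0} {α} 1≡p^α)
  q^j≡p^α⇒j*[q∸1]≡α*[p∸1] {p} {q} (suc j) α p-prime q-prime q^[1+j]≡p^α
    with prime⇒irreducible p-prime (prime∣m^n⇒∣m q-prime α (divides (q ^ j) (trans (sym q^[1+j]≡p^α) (ℕ.*-comm q (q ^ j)))))
  ... | inj₁ q≡1 = contradiction q≡1 (prime≢1 q-prime)
  ... | inj₂ refl = cong (_* (q ∸ 1)) (^-injectiveʳ (1<prime q-prime) {suc j} {α} q^[1+j]≡p^α)

module FactorReduction (σ : Signature) (B : Algebra σ)
  (isAbelianGroup : IsAbelianGroup _≡_ (Algebra._⊕_ B) (Algebra.𝟎 B) (Algebra.⊖_ B))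
  (q′ : ℕ) (q-prime : Prime (suc q′)) (q·≡𝟎 : ∀ x → _·_ σ {B} (suc q′) x ≡ Algebra.𝟎 B)
  (k : ℕ) (supernilpotent : SuperNilpotent σ k B)
  {p α : ℕ} (p-prime : Prime p) (card : Algebra.Carrier B ↔ Fin (p ^ α))
  {n s : ℕ} {W : Set} (F : Fin s → Term σ (Fin n ⊎ W)) (κ : W → Algebra.Carrier B)
  where

  open import Data.Nat as ℕ using (zero; _+_; _*_; _∸_; _≤_; _<_; z≤n; s≤s)
  open import Data.Nat.Primality using (prime⇒nonTrivial)
  open import Data.Fin as Fin using (zero; suc; toℕ; punchIn; punchOut)
  open import Data.Sum using (inj₁; inj₂; [_,_]′)
  open import Data.Product using (∃; _,_; proj₁; proj₂; _×_)
  open import Relation.Binary.PropositionalEquality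
  import Algebra.Bundles
  import Data.Nat.Properties as ℕ
  open import Data.Nat.Induction using (<-wellFounded)
  import Data.Nat.Tactic.RingSolver as ℕ-Solver
  import Data.Integer.Tactic.RingSolver as ℤ-Solver
  import Data.Fin.Properties as Fin
  open import Data.Integer as ℤ using (ℤ; +_)
  import Data.Integer.Properties as ℤ
  open import Data.Vec using (Vec; lookup; replicate)
  open import Data.Vec.Properties using (lookup-replicate)
  import Data.Vec.Properties as Vec
  import Data.Bool as Bool
  open import Data.Bool using (Bool; true; false; if_then_else_)
  open import Relation.Nullary using (Dec; yes; no; ¬?; contradiction)
  open import Relation.Nullary.Decidable using (_×-dec_; decidable-stable)
  open import Induction.WellFounded using (Acc; acc)
  open FiniteSums
  open PrimePowers

  open Algebra B

  private
    q : ℕ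
    q = suc q′

    -- Compatibility of the identity congruence with the operations is extensionality of the operations.
    op-cong : ∀ j {u v} → (∀ i → u i ≡ v i) → op j u ≡ op j v
    op-cong = IsCongruence.θ-op (proj₁ supernilpotent)

    module Cube = Supernilpotent σ B isAbelianGroup op-cong k (proj₁ (proj₂ supernilpotent))
    open Terms.Evaluation σ B op-cong
    open ElementaryAbelianBasis σ B isAbelianGroup q-prime q·≡𝟎 using (module Coordinates)
    open Coordinates card
    open IntegersModulo q using (_≋_; _≉_; ≡⇒≋; ≋-refl; ≋-sym; ≋-trans; +-cong; _≋?_; %-≋; commutativeRing; *-≉0; distinctResidues)
    module ℤ/q = BooleanCube.Polynomials commutativeRing
    open Algebra.Bundles.CommutativeRing commutativeRing using (+-abelianGroup)

    1<q : 1 < q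
    1<q = ℕ.nonTrivial⇒n>1 q {{prime⇒nonTrivial q-prime}}

    1≉0 : + 1 ≉ + 0
    1≉0 = distinctResidues q-prime 1<q (s≤s z≤n) (λ ())

    ∏-≉0 : ∀ {M} m (G : Fin m → Vec Bool M → ℤ) x → (∀ i → G i x ≉ + 0) → ℤ/q.∏ m G x ≉ + 0
    ∏-≉0 zero    G x _    = 1≉0
    ∏-≉0 (suc m) G x G≉0 = *-≉0 q-prime (G≉0 zero) (∏-≉0 m (λ i → G (suc i)) x (λ i → G≉0 (suc i)))

    coordinateℤ : Fin dim → Carrier → ℤ
    coordinateℤ i x = + toℕ (coordinate i x)

    coordinateℤ-homo-⊕ : ∀ i x y → coordinateℤ i (x ⊕ y) ≋ coordinateℤ i x ℤ.+ coordinateℤ i y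
    coordinateℤ-homo-⊕ i x y =
      ≋-trans (≡⇒≋ (cong +_ (coordinate-homo-⊕ i x y)))
              (≋-trans (%-≋ _) (≡⇒≋ (ℤ.pos-+ (toℕ (coordinate i x)) (toℕ (coordinate i y)))))

    coordinateℤ-homo-− : ∀ i x y → coordinateℤ i (x ⊕ (⊖ y)) ≋ coordinateℤ i x ℤ.- coordinateℤ i y
    coordinateℤ-homo-− i x y = ≋-trans (≡⇒≋ (law (coordinateℤ i (x ⊕ (⊖ y))) (coordinateℤ i y)))
      (+-cong (≋-trans (≋-sym (coordinateℤ-homo-⊕ i (x ⊕ (⊖ y)) y)) (≡⇒≋ (cong (coordinateℤ i) x⊝y⊕y≡x)))
              (≋-refl {ℤ.- coordinateℤ i y}))
      where
      law : ∀ a b → a ≡ (a ℤ.+ b) ℤ.- b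
      law = ℤ-Solver.solve-∀
      x⊝y⊕y≡x : (x ⊕ (⊖ y)) ⊕ y ≡ x
      x⊝y⊕y≡x = trans (IsAbelianGroup.assoc isAbelianGroup x (⊖ y) y)
                  (trans (cong (x ⊕_) (IsAbelianGroup.inverseˡ isAbelianGroup y)) (IsAbelianGroup.identityʳ isAbelianGroup x))

    coordinateℤ-𝟎 : ∀ i → coordinateℤ i 𝟎 ≋ + 0
    coordinateℤ-𝟎 i = ≋-trans (≡⇒≋ (cong (coordinateℤ i) (sym (IsAbelianGroup.inverseʳ isAbelianGroup 𝟎))))
                              (≋-trans (coordinateℤ-homo-− i 𝟎 𝟎) (≡⇒≋ (ℤ.+-inverseʳ (coordinateℤ i 𝟎))))

    module Coordinateℤ (i : Fin dim) = BooleanCube.Homomorphism Cube.abelianGroup +-abelianGroup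
      (coordinateℤ i) (coordinateℤ-homo-− i)

  ⟦F⟧ : (Fin n → Carrier) → Fin s → Carrier
  ⟦F⟧ y l = eval σ B (F l) [ y , κ ]′

  nonzero : Carrier → ℕ
  nonzero x = indicator (¬? (x ≟ 𝟎))

  support : (Fin n → Carrier) → ℕ
  support y = Σ[< n ] (λ v → nonzero (y v))

  private
    nonzero-𝟎 : nonzero 𝟎 ≡ 0
    nonzero-𝟎 = indicator-no (¬? (𝟎 ≟ 𝟎)) (λ 𝟎≢𝟎 → 𝟎≢𝟎 refl)

    zeros : (Fin n → Carrier) → ℕ
    zeros y = Σ[< n ] (λ v → indicator (y v ≟ 𝟎))

    zeros+support≡n : ∀ y → zeros y + support y ≡ n
    zeros+support≡n y = begin
      zeros y + support y                                        ≡⟨ sym (Σ-homo-+ n _ _) ⟩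
      Σ[< n ] (λ v → indicator (y v ≟ 𝟎) + nonzero (y v))       ≡⟨ Σ-cong n (λ v → indicator+indicator¬≡1 (y v ≟ 𝟎)) ⟩
      Σ[< n ] (λ _ → 1)                                          ≡⟨ Σ-const n 1 ⟩
      n * 1                                                      ≡⟨ ℕ.*-identityʳ n ⟩
      n                                                          ∎
      where open ≡-Reasoning

    guard : ∀ {A : Set} → Dec A → Bool → ℤ
    guard (yes _) b = if b then + 0 else + 1
    guard (no _)  _ = + 1

    guard-false≉0 : ∀ {A : Set} (d : Dec A) → guard d false ≉ + 0
    guard-false≉0 (yes _) = 1≉0
    guard-false≉0 (no _)  = 1≉0

    guard-true≡0 : ∀ {A : Set} (d : Dec A) → A → guard d true ≡ + 0
    guard-true≡0 (yes _) _ = refl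
    guard-true≡0 (no ¬a) a = contradiction a ¬a

    guard-degree : ∀ {A : Set} (d : Dec A) v → ℤ/q.DegreeAtMost {n} (indicator d) (λ x → guard d (lookup x v))
    guard-degree (yes _) v = ℤ/q.lookup-degree (λ b → if b then + 0 else + 1) v
    guard-degree (no _)  v = ℤ/q.const-degree {d = 0} (+ 1)

  bound : ℕ
  bound = k * s * α * (p ∸ 1)

  private
    module Thinning (a : Fin n → Carrier) (large : bound < support a) where

      zeroOut : Fin n → Bool → Carrier
      zeroOut v b = if b then 𝟎 else a v

      thin : Vec Bool n → Fin n → Carrier
      thin x v = zeroOut v (lookup x v)

      value : Fin s → Vec Bool n → Carrier
      value l = Cube.cubePolynomial card (F l) κ zeroOut

      origin : Vec Bool n
      origin = replicate n false

      target : Fin s → Fin dim → Fin q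
      target l i = coordinate i (value l origin)

      coordinate-degree : ∀ l i → ℤ/q.DegreeAtMost k (λ x → coordinateℤ i (value l x))
      coordinate-degree l i = ℤ/q.DegreeAtMost-fromΔs k _ (λ js x →
        ≋-trans (Coordinateℤ.Δs-homo i js (value l) x)
                (≋-trans (≡⇒≋ (cong (coordinateℤ i) (Cube.Δs-cubePolynomial card (F l) κ zeroOut js x)))
                         (coordinateℤ-𝟎 i)))

      -- punchIn (target l i) enumerates the q′ residues other than the target, so ∏ t (miss l i t x) ≉ 0
      -- exactly when the i-th coordinate of value l x is the target.
      miss : Fin s → Fin dim → Fin q′ → Vec Bool n → ℤ
      miss l i t x = coordinateℤ i (value l x) ℤ.- + toℕ (punchIn (target l i) t)

      -- keepAll x ≉ 0 exactly when x selects only coordinates where a is nonzero, so thinning shrinks the support.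
      keep : Fin n → Vec Bool n → ℤ
      keep v x = guard (a v ≟ 𝟎) (lookup x v)

      keepAll missAll P : Vec Bool n → ℤ
      keepAll = ℤ/q.∏ n keep
      missAll = ℤ/q.∏ s (λ l → ℤ/q.∏ dim (λ i → ℤ/q.∏ q′ (miss l i)))
      P x = keepAll x ℤ.* missAll x

      missAll-degree : ℤ/q.DegreeAtMost bound missAll
      missAll-degree = subst (λ d → ℤ/q.DegreeAtMost d missAll) degree≡bound
        (ℤ/q.∏-degree s _ _ (λ l → ℤ/q.∏-degree dim _ _ (λ i → ℤ/q.∏-degree q′ (λ _ → k) _ (λ t →
          ℤ/q.−-degree {d = k} (coordinate-degree l i) (ℤ/q.const-degree {d = k} (+ toℕ (punchIn (target l i) t)))))))
        where
        open ≡-Reasoning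
        dim*q′≡α*[p∸1] : dim * q′ ≡ α * (p ∸ 1)
        dim*q′≡α*[p∸1] = q^j≡p^α⇒j*[q∸1]≡α*[p∸1] dim α p-prime q-prime q^dim≡N
        rearrange : ∀ s d q k → s * (d * (q * k)) ≡ k * s * (d * q)
        rearrange = ℕ-Solver.solve-∀
        degree≡bound : Σ[< s ] (λ _ → Σ[< dim ] (λ _ → Σ[< q′ ] (λ _ → k))) ≡ bound
        degree≡bound = begin
          Σ[< s ] (λ _ → Σ[< dim ] (λ _ → Σ[< q′ ] (λ _ → k)))
            ≡⟨ Σ-cong s (λ _ → trans (Σ-cong dim (λ _ → Σ-const q′ k)) (Σ-const dim (q′ * k))) ⟩
          Σ[< s ] (λ _ → dim * (q′ * k))  ≡⟨ Σ-const s _ ⟩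
          s * (dim * (q′ * k))            ≡⟨ rearrange s dim q′ k ⟩
          k * s * (dim * q′)              ≡⟨ cong (k * s *_) dim*q′≡α*[p∸1] ⟩
          k * s * (α * (p ∸ 1))           ≡⟨ sym (ℕ.*-assoc (k * s) α (p ∸ 1)) ⟩
          bound                           ∎

      P-degree : ℤ/q.DegreeAtMost (zeros a + bound) P
      P-degree = ℤ/q.*-degree {a = zeros a} (ℤ/q.∏-degree n _ keep (λ v → guard-degree (a v ≟ 𝟎) v)) missAll-degree

      P-degree<n : zeros a + bound < n
      P-degree<n = subst (zeros a + bound <_) (zeros+support≡n a) (ℕ.+-monoʳ-< (zeros a) large)

      P[origin]≉0 : P origin ≉ + 0
      P[origin]≉0 = *-≉0 q-prime
        (∏-≉0 n keep origin (λ v → subst (λ b → guard (a v ≟ 𝟎) b ≉ + 0) (sym (lookup-replicate v false))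
                                         (guard-false≉0 (a v ≟ 𝟎))))
        (∏-≉0 s _ origin (λ l → ∏-≉0 dim _ origin (λ i → ∏-≉0 q′ _ origin (λ t →
          distinctResidues q-prime (Fin.toℕ<n _) (Fin.toℕ<n _)
            (λ eq → Fin.punchInᵢ≢i (target l i) t (sym (Fin.toℕ-injective eq)))))))

      -- A polynomial of degree below the dimension of the cube cannot be supported at the origin alone.
      witness : ∃ λ x → x ≢ origin × P x ≉ + 0
      witness with BooleanCube.∃-cube? n (λ x → ¬? (Vec.≡-dec Bool._≟_ x origin) ×-dec ¬? (P x ≋? + 0))
      ... | yes found = found
      ... | no none = contradiction
        (ℤ/q.alternatingSum-vanishingOffOrigin n P
          (λ x x≢origin → decidable-stable (P x ≋? + 0) (λ Px≉0 → none (x , x≢origin , Px≉0)))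
          (ℤ/q.alternatingSum-degree< n P-degree P-degree<n))
        P[origin]≉0

      module _ (x : Vec Bool n) (x≢origin : x ≢ origin) (Px≉0 : P x ≉ + 0) where

        keepAll≉0 : keepAll x ≉ + 0
        keepAll≉0 keepAll≋0 = Px≉0 (ℤ/q.≈0-* {b = missAll x} keepAll≋0)

        missAll≉0 : missAll x ≉ + 0
        missAll≉0 missAll≋0 = Px≉0 (ℤ/q.*-≈0 {a = keepAll x} missAll≋0)

        skips-zeros : ∀ v → a v ≡ 𝟎 → lookup x v ≡ false
        skips-zeros v av≡𝟎 with lookup x v in x[v]≡b
        ... | false = refl
        ... | true  = contradiction
          (ℤ/q.∏-zero n keep x v (≡⇒≋ (trans (cong (guard (a v ≟ 𝟎)) x[v]≡b) (guard-true≡0 (a v ≟ 𝟎) av≡𝟎))))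
          keepAll≉0

        same-coordinates : ∀ l i → coordinate i (value l x) ≡ target l i
        same-coordinates l i with coordinate i (value l x) Fin.≟ target l i
        ... | yes same = same
        ... | no differ = contradiction
          (ℤ/q.∏-zero s _ x l (ℤ/q.∏-zero dim _ x i (ℤ/q.∏-zero q′ _ x t miss≋0)))
          missAll≉0
          where
          target≢coordinate : target l i ≢ coordinate i (value l x)
          target≢coordinate eq = differ (sym eq)
          t : Fin q′
          t = punchOut target≢coordinate
          miss≋0 : miss l i t x ≋ + 0
          miss≋0 = ≡⇒≋ (trans (cong (λ c → coordinateℤ i (value l x) ℤ.- + toℕ c) (Fin.punchIn-punchOut target≢coordinate))
                              (ℤ.+-inverseʳ (coordinateℤ i (value l x))))

        same-values : ∀ l → ⟦F⟧ (thin x) l ≡ ⟦F⟧ a l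
        same-values l = trans (coordinate-injective (same-coordinates l)) value-origin
          where
          value-origin : value l origin ≡ ⟦F⟧ a l
          value-origin = eval-cong (F l) λ { (inj₁ v) → cong (zeroOut v) (lookup-replicate v false) ; (inj₂ w) → refl }

        nonzero-thin≤ : ∀ v → nonzero (thin x v) ≤ nonzero (a v)
        nonzero-thin≤ v with lookup x v
        ... | true  = subst (_≤ nonzero (a v)) (sym nonzero-𝟎) z≤n
        ... | false = ℕ.≤-refl

        thinner : support (thin x) < support a
        thinner with BooleanCube.≢replicate-false⇒∃true x x≢origin
        ... | v , x[v]≡true = Σ-mono-< n nonzero-thin≤ v (subst₂ _<_ (sym nonzero-thin[v]) (sym nonzero-a[v]) (s≤s z≤n))
          where
          nonzero-thin[v] : nonzero (thin x v) ≡ 0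
          nonzero-thin[v] = trans (cong (λ b → nonzero (zeroOut v b)) x[v]≡true) nonzero-𝟎
          nonzero-a[v] : nonzero (a v) ≡ 1
          nonzero-a[v] = indicator-yes (¬? (a v ≟ 𝟎)) (λ av≡𝟎 → contradiction (trans (sym x[v]≡true) (skips-zeros v av≡𝟎)) λ ())

      thinning : ∃ λ a′ → support a′ < support a × (∀ l → ⟦F⟧ a′ l ≡ ⟦F⟧ a l)
      thinning = let (x , x≢origin , Px≉0) = witness in thin x , thinner x x≢origin Px≉0 , same-values x x≢origin Px≉0

  reduce : ∀ a → ∃ λ y → support y ≤ bound × (∀ l → ⟦F⟧ y l ≡ ⟦F⟧ a l)
  reduce a = descend a (<-wellFounded (support a))
    where
    descend : ∀ a → Acc _<_ (support a) → ∃ λ y → support y ≤ bound × (∀ l → ⟦F⟧ y l ≡ ⟦F⟧ a l)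
    descend a (acc smaller) with support a ℕ.≤? bound
    ... | yes small = a , small , λ _ → refl
    ... | no large with Thinning.thinning a (ℕ.≰⇒> large)
    ... | a′ , a′<a , same with descend a′ (smaller a′<a)
    ... | y , small , same′ = y , small , λ l → trans (same′ l) (same l)

open import Data.Nat using (ℕ; zero; suc; _*_; _∸_; _^_; _≤_)
import Data.Nat.Properties as ℕ
open import Data.Nat.Primality using (Prime; ¬prime[0])
import Data.Fin.Properties as Fin
open import Data.Product using (Σ; ∃; _×_; _,_; proj₁; proj₂)
open import Data.Sum using (_⊎_; inj₁; inj₂; [_,_]′)
open import Relation.Binary.PropositionalEquality
open import Relation.Nullary using (¬?; contradiction)
open FiniteSums

Reduction : (σ : Signature) (B : Algebra σ) {N : ℕ} → (Algebra.Carrier B ↔ Fin N) → ℕ →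
            ∀ {n s} {W : Set} → (Fin s → Term σ (Fin n ⊎ W)) → (W → Algebra.Carrier B) → (Fin n → Algebra.Carrier B) → Set
Reduction σ B card bound {n} F κ a =
  ∃ λ y → Σ[< n ] (λ v → indicator (¬? (↔Fin-deq card (y v) (Algebra.𝟎 B)))) ≤ bound
        × (∀ l → eval σ B (F l) [ y , κ ]′ ≡ eval σ B (F l) [ a , κ ]′)

reduceFactor : ∀ (σ : Signature) (B : Algebra σ) → IsExpElemAbelian σ B → ∀ k → SuperNilpotent σ k B →
  ∀ {p α} → Prime p → (card : Algebra.Carrier B ↔ Fin (p ^ α)) →
  ∀ {n s} {W : Set} (F : Fin s → Term σ (Fin n ⊎ W)) κ a → Reduction σ B card (k * s * α * (p ∸ 1)) F κ a
reduceFactor σ B record { exponent = zero ; exponent-prime = 0-prime } _ _ _ _ _ _ _ = contradiction 0-prime ¬prime[0]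
reduceFactor σ B record { isAbelianGroup = isAbelianGroup ; exponent = suc q′ ; exponent-prime = q-prime ; exponent-kills = q·≡𝟎 }
             k supernilpotent p-prime card F κ =
  FactorReduction.reduce σ B isAbelianGroup q′ q-prime q·≡𝟎 k supernilpotent p-prime card F κ

wt≤Σ : ∀ (σ : Signature) {t n} (B : Fin t → Algebra σ) deq (y : Fin n → Algebra.Carrier (Prod σ B)) →
       wt σ B deq y ≤ Σ[< t ] (λ i → Σ[< n ] (λ j → indicator (¬? (deq i (y j i) (Algebra.𝟎 (B i))))))
wt≤Σ σ {t} {n} B deq y = begin
  wt σ B deq y
    ≡⟨ length-filter-tabulate n _ (λ j → j) ⟩
  Σ[< n ] (λ j → indicator (¬? (Fin.all? (λ i → deq i (y j i) (Algebra.𝟎 (B i))))))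
    ≤⟨ Σ-mono-≤ n (λ j → indicator¬all≤Σ t (λ i → deq i (y j i) (Algebra.𝟎 (B i)))) ⟩
  Σ[< n ] (λ j → Σ[< t ] (λ i → indicator (¬? (deq i (y j i) (Algebra.𝟎 (B i))))))
    ≡⟨ Σ-swap n t _ ⟩
  Σ[< t ] (λ i → Σ[< n ] (λ j → indicator (¬? (deq i (y j i) (Algebra.𝟎 (B i)))))) ∎
  where open ℕ.≤-Reasoning

module Product (σ : Signature) {t : ℕ} (B : Fin t → Algebra σ)
  (op-cong : ∀ i j {u v} → (∀ l → u l ≡ v l) → Algebra.op (B i) j u ≡ Algebra.op (B i) j v) where

  eval-Prod : ∀ {V : Set} (u : Term σ V) (ρ : V → Algebra.Carrier (Prod σ B)) i →
              eval σ (Prod σ B) u ρ i ≡ eval σ (B i) u (λ v → ρ v i)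
  eval-Prod (var v)    ρ i = refl
  eval-Prod (plus u w) ρ i = cong₂ (Algebra._⊕_ (B i)) (eval-Prod u ρ i) (eval-Prod w ρ i)
  eval-Prod (neg u)    ρ i = cong (Algebra.⊖_ (B i)) (eval-Prod u ρ i)
  eval-Prod zer        ρ i = refl
  eval-Prod (app j us) ρ i = op-cong i j (λ l → eval-Prod (us l) ρ i)

  PolMap-component : ∀ {n s} (F : Fin s → PolTerm σ (Prod σ B) (Fin n)) z l i →
                     PolMap σ (Prod σ B) n s F z l i ≡ eval σ (B i) (F l) [ (λ j → z j i) , (λ c → c i) ]′
  PolMap-component F z l i = trans (eval-Prod (F l) _ i) (Terms.Evaluation.eval-cong σ (B i) (op-cong i) (F l) componentwise)
    where
    componentwise : ∀ v → [ z , (λ c → c) ]′ v i ≡ [ (λ j → z j i) , (λ c → c i) ]′ v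
    componentwise (inj₁ j) = refl
    componentwise (inj₂ c) = refl

theorem4p3 : (σ : Signature) (n s t : ℕ) (k : Fin t → ℕ) (B : Fin t → Algebra σ)
    (p α : Fin t → ℕ) →
    (∀ i → Prime (p i)) →
    (∀ i → IsExpElemAbelian σ (B i)) →
    (∀ i → SuperNilpotent σ (k i) (B i)) →
    (card : ∀ i → Algebra.Carrier (B i) ↔ Fin (p i ^ α i)) →
    (F : Fin s → PolTerm σ (Prod σ B) (Fin n)) →
    (a : Fin n → Algebra.Carrier (Prod σ B)) →
    Σ (Fin n → Algebra.Carrier (Prod σ B)) (λ y →
      (wt σ B (λ i → ↔Fin-deq (card i)) y ≤ Σ[< t ] (λ i → k i * s * α i * (p i ∸ 1)))
      × (∀ l → _≈ᴾ_ σ {B = B} (PolMap σ (Prod σ B) n s F a l) (PolMap σ (Prod σ B) n s F y l)))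
theorem4p3 σ n s t k B p α primes elementary supernilpotent card F a = y , weight-bound , same-values
  where
  open Product σ B (λ i → IsCongruence.θ-op (proj₁ (supernilpotent i)))

  reduced : ∀ i → Reduction σ (B i) (card i) (k i * s * α i * (p i ∸ 1)) F (λ c → c i) (λ j → a j i)
  reduced i = reduceFactor σ (B i) (elementary i) (k i) (supernilpotent i) (primes i) (card i)
                           F (λ c → c i) (λ j → a j i)

  y : Fin n → Algebra.Carrier (Prod σ B)
  y j i = proj₁ (reduced i) j

  weight-bound : wt σ B (λ i → ↔Fin-deq (card i)) y ≤ Σ[< t ] (λ i → k i * s * α i * (p i ∸ 1))
  weight-bound = ℕ.≤-trans (wt≤Σ σ B (λ i → ↔Fin-deq (card i)) y) (Σ-mono-≤ t (λ i → proj₁ (proj₂ (reduced i))))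

  same-values : ∀ l → _≈ᴾ_ σ {B = B} (PolMap σ (Prod σ B) n s F a l) (PolMap σ (Prod σ B) n s F y l)
  same-values l i = trans (PolMap-component F a l i)
                          (trans (sym (proj₂ (proj₂ (reduced i)) l)) (sym (PolMap-component F y l i)))
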